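{- Let $n\geq 3$ and $1\leq d<n$, and let $\mathrm{Aut}(\mathbb{Z}_n)$ act on $\mathcal G_n^d$ componentwise. Then: (a) For any $k\in \mathrm{Aut}(\mathbb{Z}_n)$ and any $\mathbf{x}\in\mathcal G_n^d$, $k$ lies in the stabilizer $\mathrm{Stab}(\mathbf{x})$ if and only if $\frac{n}{\gcd(k-1,n)}$ divides $\gcd(\mathbf{x},n)$. In particular, if $\gcd(\mathbf{x},n)=1$ then $\mathrm{Stab}(\mathbf{x})=\{1\}$. (b) The number of orbits of the restricted action of $\mathrm{Aut}(\mathbb{Z}_n)$ on $\mathcal I_n^d$ is $\beta_n^d/\phi(n)$. Thus $\phi(n)$ divides $\beta_n^d$. (c) $\alpha_n^d=\sum_{m\mid n,\ m\geq 1}\beta_m^d$ and $\beta_n^d=\sum_{m\mid n,\ m\geq 1}\mu\left(\frac{n}{m}\right)\alpha_m^d$, where $\mu$ is the Möbius function. (d) If $d\geq \max\{m:\ 1\leq m<n,\ m\mid n\}$, then $\alpha_n^d=\beta_n^d$ and $\phi(n)$ divides $\alpha_n^d$. Moreover, the same conclusion holds if $d\geq n/2$.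
   Context: For a positive integer $m$, $\mathbb{Z}_m$ is the ring of integers modulo $m$, identified with $\{0,1,\dots,m-1\}$. A vector $(v_1,\dots,v_d)\in\mathbb{Z}_m^d$ is zero-sum-free if there is no non-empty subset of its components whose sum is $0$ in $\mathbb{Z}_m$. $\mathcal G_m^d$ denotes the set of zero-sum-free $d$-tuples in $\mathbb{Z}_m^d$ and $\alpha_m^d=|\mathcal G_m^d|$. For $\mathbf{x}=(x_1,\dots,x_d)$, $\gcd(\mathbf{x},m):=\gcd(x_1,\dots,x_d,m)$ (computed with representatives in $\{0,\dots,m-1\}$); $\mathbf{x}\in\mathcal G_m^d$ is irreducible if $\gcd(\mathbf{x},m)=1$. $\mathcal I_m^d$ is the set of irreducible zero-sum-free $d$-tuples in $\mathbb{Z}_m^d$ and $\beta_m^d=|\mathcal I_m^d|$. $\mathrm{Aut}(\mathbb{Z}_n)$ is identified with $\{k: 1\le k\le n-1,\ \gcd(k,n)=1\}$, acting on $d$-tuples by $k\cdot(x_1,\dots,x_d)=(kx_1,\dots,kx_d)$. $\phi$ is Euler's totient function. -}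

module Defs where

open import Data.Nat using (ℕ; zero; suc; _+_; _*_; _∸_; _≤_; _<_)
open import Data.Nat.DivMod using (_/_; _mod_)
open import Data.Nat.Divisibility using (_∣_; _∣?_)
open import Data.Nat.GCD using (gcd)
open import Data.Nat.Coprimality using (Coprime; coprime?)
open import Data.Nat.Primality using (Prime; prime?)
open import Data.Integer as ℤ using (ℤ; +_; -_)
open import Data.Fin using (Fin; toℕ)
open import Data.Fin.Subset using (Subset; Nonempty; inside; outside)
open import Data.Fin.Subset.Properties using (anySubset?; nonempty?)
open import Data.Vec as Vec using (Vec; []; _∷_)
open import Data.List as List using (List; length; filter; allFin; concatMap; upTo; foldr)
open import Data.List.Relation.Unary.All using (All; all?)
open import Data.List.Relation.Unary.Any using (Any)
open import Data.List.Relation.Unary.AllPairs using (AllPairs)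
open import Data.List.Membership.Propositional using (_∈_)
open import Data.Product using (Σ; ∃; _×_; _,_)
open import Relation.Nullary using (Dec; ¬_; yes; no)
open import Relation.Nullary using (¬?)
open import Relation.Nullary.Decidable using (_×-dec_)
import Relation.Nullary.Decidable as Dec
open import Relation.Binary.PropositionalEquality using (_≡_)
open import Data.Nat.Properties using (_≟_)

-- Z_m is Fin m (representatives 0..m-1); d-tuples are Vec (Fin m) d.

subsetSum : ∀ {m d} → Subset d → Vec (Fin m) d → ℕ
subsetSum []            []      = 0
subsetSum (inside ∷ S)  (a ∷ x) = toℕ a + subsetSum S x
subsetSum (outside ∷ S) (a ∷ x) = subsetSum S x

ZeroSumSubset : ∀ {d} (m : ℕ) → Vec (Fin m) d → Subset d → Set
ZeroSumSubset m x S = Nonempty S × (m ∣ subsetSum S x)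

ZeroSumFree : ∀ {d} (m : ℕ) → Vec (Fin m) d → Set
ZeroSumFree m x = ¬ (∃ λ S → ZeroSumSubset m x S)

zeroSumFree? : ∀ {d} (m : ℕ) (x : Vec (Fin m) d) → Dec (ZeroSumFree m x)
zeroSumFree? m x = ¬? (anySubset? (λ S → nonempty? S ×-dec (m ∣? subsetSum S x)))

gcdVec : ∀ {d} (m : ℕ) → Vec (Fin m) d → ℕ
gcdVec m x = Vec.foldr _ (λ a g → gcd (toℕ a) g) m x

Irreducible : ∀ {d} (m : ℕ) → Vec (Fin m) d → Set
Irreducible m x = ZeroSumFree m x × gcdVec m x ≡ 1

irreducible? : ∀ {d} (m : ℕ) (x : Vec (Fin m) d) → Dec (Irreducible m x)
irreducible? m x = zeroSumFree? m x ×-dec (gcdVec m x ≟ 1)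

allTuples : (m d : ℕ) → List (Vec (Fin m) d)
allTuples m zero    = [] List.∷ List.[]
allTuples m (suc d) = concatMap (λ a → List.map (a ∷_) (allTuples m d)) (allFin m)

α : (m d : ℕ) → ℕ
α m d = length (filter (zeroSumFree? m) (allTuples m d))

β : (m d : ℕ) → ℕ
β m d = length (filter (irreducible? m) (allTuples m d))

oneTo : ℕ → List ℕ
oneTo n = List.map suc (upTo n)

φ : ℕ → ℕ
φ n = length (filter (λ k → coprime? k n) (oneTo n))

-- integer division; the divisor-0 case is never used in the statement
_div_ : ℕ → ℕ → ℕ
x div zero    = 0
x div (suc g) = x / suc g

divisors : ℕ → List ℕ
divisors n = filter (λ m → m ∣? n) (oneTo n)

Σdiv : ℕ → (ℕ → ℕ) → ℕ
Σdiv n f = foldr (λ m s → f m + s) 0 (divisors n)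

Σdivℤ : ℕ → (ℕ → ℤ) → ℤ
Σdivℤ n f = foldr (λ m s → f m ℤ.+ s) (+ 0) (divisors n)

SquareFree : ℕ → Set
SquareFree n = All (λ k → ¬ (k * k ∣ n)) (List.map suc (oneTo n))   -- k = 2..n+1

squareFree? : (n : ℕ) → Dec (SquareFree n)
squareFree? n = all? (λ k → ¬? (k * k ∣? n)) (List.map suc (oneTo n))

ω : ℕ → ℕ
ω n = length (filter (λ p → prime? p ×-dec (p ∣? n)) (oneTo n))

negOnePow : ℕ → ℤ
negOnePow zero    = + 1
negOnePow (suc k) = - negOnePow k

μ : ℕ → ℤ
μ n with squareFree? n
... | yes _ = negOnePow (ω n)
... | no  _ = + 0

IsAut : ℕ → ℕ → Set
IsAut n k = 1 ≤ k × k < n × Coprime k n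

act : ∀ {n d} → ℕ → Vec (Fin n) d → Vec (Fin n) d
act {zero}  k x = x
act {suc n} k x = Vec.map (λ a → (k * toℕ a) mod (suc n)) x

InStab : ∀ {n d} → ℕ → Vec (Fin n) d → Set
InStab {n} k x = IsAut n k × act k x ≡ x

SameOrbit : ∀ {n d} → Vec (Fin n) d → Vec (Fin n) d → Set
SameOrbit {n} x y = ∃ λ k → IsAut n k × act k x ≡ y

-- The number of orbits
-- is the length of any such R.
OrbitTransversal : (n d : ℕ) → List (Vec (Fin n) d) → Set
OrbitTransversal n d R =
  All (Irreducible n) R
  × (∀ x → Irreducible n x → Any (λ r → SameOrbit x r) R)
  × AllPairs (λ r s → ¬ SameOrbit r s) R

-- (a) Multiplication by k fixes a coordinate a of Z_n exactly when n ∣ (k − 1) a, i.e. when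
-- n / gcd(k − 1, n) divides a; so whether k stabilises x depends only on gcd(x, n), and
-- irreducible tuples have trivial stabilisers.
-- (b) Hence Aut(Z_n) acts freely on I_n^d: every orbit has φ(n) elements, and summing over a
-- transversal gives β_n^d = (number of orbits) · φ(n).
-- (c) The zero-sum-free tuples x with gcd(x, n) = g are exactly g times the irreducible tuples of
-- Z_(n/g); sorting G_n^d by this gcd gives α_n = Σ_{m ∣ n} β_m, and Möbius inversion (via
-- Σ_{e ∣ N} μ(e) = [N = 1]) turns it around.
-- (d) Among d ≥ m elements of Z_m two of the d + 1 prefix sums agree modulo m, so a block of
-- consecutive elements sums to zero; thus β_m^d = 0 for every proper divisor m ≤ d of n, and the
-- sum for α_n collapses to β_n.
module Submission where

open import Defs
open import Data.Nat using (ℕ; _≤_; _<_; _*_; _∸_)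
open import Data.Nat.Divisibility using (_∣_)
open import Data.Nat.GCD using (gcd)
open import Data.Integer using (ℤ; +_) renaming (_*_ to _*ℤ_)
open import Data.Fin using (Fin)
open import Data.Vec using (Vec)
open import Data.List using (List; length)
open import Data.Product using (∃; _×_)
open import Function.Bundles using (_⇔_)
open import Relation.Binary.PropositionalEquality using (_≡_)

open import Level using (Level)
open import Algebra.Bundles using (CommutativeSemiring)
open import Data.Nat as ℕ using (zero; suc; s≤s; z≤n; NonZero)
import Data.Nat.Properties as ℕP
open import Data.Nat.DivMod
  using (_/_; _%_; _mod_; m≡m%n+[m/n]*n; m/n*n≡m; m*n/n≡m; m<n⇒m%n≡m; m%n%n≡m%n; m%n<n; m<n*o⇒m/o<n;
         %-remove-+ʳ; %-distribˡ-*; %-distribˡ-+)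
open import Data.Nat.Divisibility
  using (divides; _∣?_; ∣-refl; ∣-trans; 0∣⇒≡0; 1∣_; ∣1⇒≡1; ∣⇒≤; ∣m+n∣m⇒∣n; ∣m⇒∣m*n; ∣n⇒∣m*n;
         ∣n∣m%n⇒∣m; %-presˡ-∣; n∣m⇒m%n≡0; m%n≡0⇒n∣m; *-pres-∣; *-monoʳ-∣; *-monoˡ-∣; *-cancelˡ-∣; *-cancelʳ-∣)
open import Data.Nat.GCD
  using (module Bézout; gcd[m,n]∣m; gcd[m,n]∣n; gcd[m,n]≢0; gcd-identityˡ; gcd-greatest; c*gcd[m,n]≡gcd[cm,cn])
open import Data.Nat.Coprimality
  using (Coprime; coprime?; coprime-/gcd; coprime-divisor; coprime-Bézout; 0-coprimeTo-m⇒m≡1; 1-coprimeTo)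
import Data.Nat.Coprimality as Coprime
open import Data.Nat.Primality using (Prime; prime?; euclidsLemma; prime⇒irreducible; prime⇒nonTrivial; prime⇒nonZero)
open import Data.Nat.Primality.Factorisation using (factorise)
open import Data.Nat.ListAction using (product)
open import Data.Nat.Tactic.RingSolver using (solve-∀)
import Data.Integer as ℤ
import Data.Integer.Properties as ℤP
open import Data.Fin as F using (toℕ)
import Data.Fin.Properties as FP
open import Data.Fin.Subset using (Subset; inside; outside; Nonempty)
open import Data.Vec as V using ([]; _∷_)
import Data.Vec.Properties as VP
import Data.Vec.Relation.Unary.All as VAll
open import Data.List as L using ([]; _∷_; filter; foldr; allFin; deduplicate)
open import Data.List.Membership.Propositional using (_∈_; find)
open import Data.List.Membership.Propositional.Properties
  using (∈-map⁺; ∈-map⁻; ∈-upTo⁺; ∈-upTo⁻; ∈-filter⁺; ∈-filter⁻; ∈-allFin; ∈-concatMap⁺; ∈-length)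
open import Data.List.Relation.Unary.Any as Any using (here; there)
import Data.List.Relation.Unary.Any.Properties as Any
import Data.List.Relation.Unary.All as All
import Data.List.Relation.Unary.All.Properties as All
open import Data.List.Relation.Unary.AllPairs as AllPairs using (AllPairs; []; _∷_)
import Data.List.Relation.Unary.AllPairs.Properties as AllPairs
open import Data.List.Relation.Unary.Unique.Propositional using (Unique)
import Data.List.Relation.Unary.Unique.Propositional.Properties as Unique
open import Data.Product using (_,_; proj₁; proj₂)
open import Data.Sum using (_⊎_; inj₁; inj₂; [_,_])
open import Function using (_∘_)
open import Function.Bundles using (mk⇔; Equivalence)
open import Relation.Nullary using (Dec; yes; no; ¬_; ¬?; contradiction)
open import Relation.Nullary.Decidable using (_×-dec_)
import Relation.Nullary.Decidable as Dec
open import Relation.Binary.Definitions using (DecidableEquality)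
open import Relation.Binary.PropositionalEquality as ≡
  using (_≢_; refl; sym; trans; cong; cong₂; subst; subst₂)

private
  variable
    a b p : Level
    A : Set a
    B : Set b

module ListSum {c ℓ} (S : CommutativeSemiring c ℓ) where

  open CommutativeSemiring S renaming (_*_ to _·_; refl to ≈-refl; sym to ≈-sym; trans to ≈-trans)
  open import Algebra.Properties.CommutativeSemigroup +-commutativeSemigroup using (interchange; x∙yz≈y∙xz)
  open import Relation.Binary.Reasoning.Setoid setoid

  ∑ : List A → (A → Carrier) → Carrier
  ∑ xs f = foldr (λ x s → f x + s) 0# xs

  indicator : {P : Set p} → Dec P → Carrier
  indicator (yes _) = 1#
  indicator (no _)  = 0#

  indicator-yes : {P : Set p} (P? : Dec P) → P → indicator P? ≈ 1#
  indicator-yes (yes _) _ = ≈-refl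
  indicator-yes (no ¬p) p = contradiction p ¬p

  indicator-no : {P : Set p} (P? : Dec P) → ¬ P → indicator P? ≈ 0#
  indicator-no (yes p) ¬p = contradiction p ¬p
  indicator-no (no _)  _  = ≈-refl

  indicator-cong : ∀ {q} {P : Set p} {Q : Set q} (P? : Dec P) (Q? : Dec Q) → P ⇔ Q → indicator P? ≈ indicator Q?
  indicator-cong (yes _) (yes _) _   = ≈-refl
  indicator-cong (no _)  (no _)  _   = ≈-refl
  indicator-cong (yes p) (no ¬q) P⇔Q = contradiction (Equivalence.to P⇔Q p) ¬q
  indicator-cong (no ¬p) (yes q) P⇔Q = contradiction (Equivalence.from P⇔Q q) ¬p

  indicator-*-yes : {P : Set p} (P? : Dec P) → P → ∀ x → indicator P? · x ≈ x
  indicator-*-yes (yes _) _ x = *-identityˡ x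
  indicator-*-yes (no ¬p) p x = contradiction p ¬p

  indicator-*-no : {P : Set p} (P? : Dec P) → ¬ P → ∀ x → indicator P? · x ≈ 0#
  indicator-*-no (yes p) ¬p x = contradiction p ¬p
  indicator-*-no (no _)  _  x = zeroˡ x

  indicator-⊎ : ∀ {p q r} {P : Set p} {Q : Set q} {R : Set r} (P? : Dec P) (Q? : Dec Q) (R? : Dec R) →
                (P → Q ⊎ R) → (Q → P) → (R → P) → ¬ (Q × R) → indicator P? ≈ indicator Q? + indicator R?
  indicator-⊎ (yes _)  (yes q)  (yes r)  _     _   _   Q∩R=∅ = contradiction (q , r) Q∩R=∅
  indicator-⊎ (yes _)  (yes _)  (no _)   _     _   _   _     = ≈-sym (+-identityʳ 1#)
  indicator-⊎ (yes _)  (no _)   (yes _)  _     _   _   _     = ≈-sym (+-identityˡ 1#)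
  indicator-⊎ (yes p)  (no ¬q)  (no ¬r)  P⊆Q∪R _   _   _     = contradiction (P⊆Q∪R p) [ ¬q , ¬r ]
  indicator-⊎ (no ¬p)  (yes q)  _        _     Q⊆P _   _     = contradiction (Q⊆P q) ¬p
  indicator-⊎ (no ¬p)  (no _)   (yes r)  _     _   R⊆P _     = contradiction (R⊆P r) ¬p
  indicator-⊎ (no _)   (no _)   (no _)   _     _   _   _     = ≈-sym (+-identityˡ 0#)

  ∑-cong : ∀ (xs : List A) {f g} → (∀ {x} → x ∈ xs → f x ≈ g x) → ∑ xs f ≈ ∑ xs g
  ∑-cong []       _   = ≈-refl
  ∑-cong (x ∷ xs) f≈g = +-cong (f≈g (here refl)) (∑-cong xs (f≈g ∘ there))

  ∑-zero : ∀ (xs : List A) {f} → (∀ {x} → x ∈ xs → f x ≈ 0#) → ∑ xs f ≈ 0#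
  ∑-zero []       _   = ≈-refl
  ∑-zero (x ∷ xs) f≈0 = ≈-trans (+-cong (f≈0 (here refl)) (∑-zero xs (f≈0 ∘ there))) (+-identityˡ 0#)

  ∑-distrib-+ : ∀ (xs : List A) f g → ∑ xs (λ x → f x + g x) ≈ ∑ xs f + ∑ xs g
  ∑-distrib-+ []       f g = ≈-sym (+-identityˡ 0#)
  ∑-distrib-+ (x ∷ xs) f g =
    ≈-trans (+-congˡ (∑-distrib-+ xs f g)) (interchange (f x) (g x) (∑ xs f) (∑ xs g))

  ∑-distribˡ-* : ∀ (xs : List A) k f → ∑ xs (λ x → k · f x) ≈ k · ∑ xs f
  ∑-distribˡ-* []       k f = ≈-sym (zeroʳ k)
  ∑-distribˡ-* (x ∷ xs) k f = ≈-trans (+-congˡ (∑-distribˡ-* xs k f)) (≈-sym (distribˡ k (f x) (∑ xs f)))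

  ∑-distribʳ-* : ∀ (xs : List A) k f → ∑ xs (λ x → f x · k) ≈ ∑ xs f · k
  ∑-distribʳ-* xs k f = begin
    ∑ xs (λ x → f x · k) ≈⟨ ∑-cong xs (λ {x} _ → *-comm (f x) k) ⟩
    ∑ xs (λ x → k · f x) ≈⟨ ∑-distribˡ-* xs k f ⟩
    k · ∑ xs f           ≈⟨ *-comm k (∑ xs f) ⟩
    ∑ xs f · k           ∎

  ∑-comm : ∀ (xs : List A) (ys : List B) (h : A → B → Carrier) →
           ∑ xs (λ x → ∑ ys (h x)) ≈ ∑ ys (λ y → ∑ xs (λ x → h x y))
  ∑-comm []       ys h = ≈-sym (∑-zero ys (λ _ → ≈-refl))
  ∑-comm (x ∷ xs) ys h =
    ≈-trans (+-congˡ (∑-comm xs ys h)) (≈-sym (∑-distrib-+ ys (h x) (λ y → ∑ xs (λ x → h x y))))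

  ∑-partition : ∀ {P : A → Set p} (P? : ∀ x → Dec (P x)) xs f →
                ∑ xs f ≈ ∑ (filter P? xs) f + ∑ (filter (¬? ∘ P?) xs) f
  ∑-partition P? []       f = ≈-sym (+-identityˡ 0#)
  ∑-partition P? (x ∷ xs) f with P? x
  ... | yes _ = ≈-trans (+-congˡ (∑-partition P? xs f)) (≈-sym (+-assoc (f x) _ _))
  ... | no  _ = ≈-trans (+-congˡ (∑-partition P? xs f)) (x∙yz≈y∙xz (f x) _ _)

  ∑-single : ∀ {xs : List A} {x f} → Unique xs → x ∈ xs →
             (∀ {y} → y ∈ xs → y ≢ x → f y ≈ 0#) → ∑ xs f ≈ f x
  ∑-single {xs = _ ∷ xs} (x≢xs ∷ _) (here refl) f≈0 =
    ≈-trans (+-congˡ (∑-zero xs (λ y∈ → f≈0 (there y∈) (≡.≢-sym (All.lookup x≢xs y∈))))) (+-identityʳ _)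
  ∑-single {xs = y ∷ _} (y≢xs ∷ u) (there x∈) f≈0 =
    ≈-trans (+-cong (f≈0 (here refl) (All.lookup y≢xs x∈)) (∑-single u x∈ (f≈0 ∘ there))) (+-identityˡ _)

  ∑-reindex : (_≟_ : DecidableEquality B) {xs : List A} {ys : List B} (f : A → B) (g : B → Carrier) →
              Unique xs → Unique ys →
              (∀ {x} → x ∈ xs → f x ∈ ys) →
              (∀ {x x′} → x ∈ xs → x′ ∈ xs → f x ≡ f x′ → x ≡ x′) →
              (∀ {y} → y ∈ ys → g y ≈ 0# ⊎ ∃ λ x → x ∈ xs × f x ≡ y) →
              ∑ ys g ≈ ∑ xs (g ∘ f)
  ∑-reindex _≟_ {xs} {ys} f g uxs uys maps inj onto = begin
    ∑ ys g                                             ≈⟨ ∑-cong ys fibre ⟩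
    ∑ ys (λ y → ∑ xs (λ x → indicator (f x ≟ y) · g y)) ≈⟨ ∑-comm ys xs _ ⟩
    ∑ xs (λ x → ∑ ys (λ y → indicator (f x ≟ y) · g y)) ≈⟨ ∑-cong xs point ⟩
    ∑ xs (g ∘ f)                                        ∎
    where
    fibre : ∀ {y} → y ∈ ys → g y ≈ ∑ xs (λ x → indicator (f x ≟ y) · g y)
    fibre y∈ with onto y∈
    ... | inj₁ gy≈0 =
      ≈-trans gy≈0 (≈-sym (∑-zero xs (λ {x} _ → ≈-trans (*-congˡ gy≈0) (zeroʳ (indicator (f x ≟ _))))))
    ... | inj₂ (x₀ , x₀∈ , refl) =
      ≈-sym (≈-trans (∑-single uxs x₀∈ (λ x∈ x≢x₀ → indicator-*-no (f _ ≟ f x₀) (x≢x₀ ∘ inj x∈ x₀∈) _))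
                 (indicator-*-yes (f x₀ ≟ f x₀) refl _))
    point : ∀ {x} → x ∈ xs → ∑ ys (λ y → indicator (f x ≟ y) · g y) ≈ g (f x)
    point {x} x∈ = ≈-trans (∑-single uys (maps x∈) (λ _ y≢fx → indicator-*-no (f x ≟ _) (y≢fx ∘ ≡.sym) _))
                         (indicator-*-yes (f x ≟ f x) refl _)

allPairs-∈ : ∀ {r} {R : A → A → Set r} {xs : List A} {x y} →
             AllPairs R xs → x ∈ xs → y ∈ xs → x ≢ y → R x y ⊎ R y x
allPairs-∈ (_  ∷ _)  (here refl) (here refl) x≢y = contradiction refl x≢y
allPairs-∈ (Rx ∷ _)  (here refl) (there y∈)  _   = inj₁ (All.lookup Rx y∈)
allPairs-∈ (Ry ∷ _)  (there x∈)  (here refl) _   = inj₂ (All.lookup Ry x∈)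
allPairs-∈ (_  ∷ Rs) (there x∈)  (there y∈)  x≢y = allPairs-∈ Rs x∈ y∈ x≢y

deduplicate-apart : ∀ {r} {R : A → A → Set r} (R? : ∀ x y → Dec (R x y)) xs →
                    AllPairs (λ x y → ¬ R x y) (deduplicate R? xs)
deduplicate-apart R? []       = []
deduplicate-apart R? (x ∷ xs) =
  All.all-filter (¬? ∘ R? x) (deduplicate R? xs) ∷ AllPairs.filter⁺ (¬? ∘ R? x) (deduplicate-apart R? xs)

map-injective : ∀ {f : A → B} → (∀ {x y} → f x ≡ f y → x ≡ y) →
                ∀ {d} {xs ys : Vec A d} → V.map f xs ≡ V.map f ys → xs ≡ ys
map-injective f-inj {xs = []}     {[]}     _  = refl
map-injective f-inj {xs = x ∷ xs} {y ∷ ys} eq =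
  cong₂ _∷_ (f-inj (VP.∷-injectiveˡ eq)) (map-injective f-inj (VP.∷-injectiveʳ eq))

oneTo-unique : ∀ n → Unique (oneTo n)
oneTo-unique n = Unique.map⁺ ℕP.suc-injective (Unique.upTo⁺ n)

∈-oneTo⁺ : ∀ {n k} → 1 ≤ k → k ≤ n → k ∈ oneTo n
∈-oneTo⁺ {k = suc k} _ k<n = ∈-map⁺ suc (∈-upTo⁺ k<n)

∈-oneTo⁻ : ∀ n {k} → k ∈ oneTo n → 1 ≤ k × k ≤ n
∈-oneTo⁻ n k∈ with ∈-map⁻ suc k∈
... | _ , i∈ , refl = s≤s z≤n , ∈-upTo⁻ i∈

divisors-unique : ∀ n → Unique (divisors n)
divisors-unique n = Unique.filter⁺ (_∣? n) (oneTo-unique n)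

∈-divisors⁺ : ∀ {n m} → 1 ≤ n → m ∣ n → m ∈ divisors n
∈-divisors⁺ {suc n} {zero}  _ 0∣n = contradiction (0∣⇒≡0 0∣n) λ ()
∈-divisors⁺ {suc n} {suc m} _ m∣n = ∈-filter⁺ (_∣? suc n) (∈-oneTo⁺ (s≤s z≤n) (∣⇒≤ m∣n)) m∣n

∈-divisors⁻ : ∀ n {m} → m ∈ divisors n → m ∣ n × 1 ≤ m
∈-divisors⁻ n m∈ with ∈-filter⁻ (_∣? n) {xs = oneTo n} m∈
... | m∈oneTo , m∣n = m∣n , proj₁ (∈-oneTo⁻ n m∈oneTo)

div≡/ : ∀ m n .{{_ : NonZero n}} → m div n ≡ m / n
div≡/ m (suc n) = refl

∣⇒positive : ∀ {m n} → 1 ≤ m → n ∣ m → 1 ≤ n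
∣⇒positive {suc m} {zero}  _ 0∣m = contradiction (0∣⇒≡0 0∣m) λ ()
∣⇒positive {n = suc n}     _ _   = s≤s z≤n

div*≡ : ∀ {m n} → 1 ≤ m → n ∣ m → m div n * n ≡ m
div*≡ {suc m} {zero}  _ 0∣m = contradiction (0∣⇒≡0 0∣m) λ ()
div*≡ {n = suc n}     _ n∣m = m/n*n≡m n∣m

div-unique : ∀ {m n q} → 1 ≤ n → q * n ≡ m → m div n ≡ q
div-unique {n = suc n} {q} _ refl = m*n/n≡m q (suc n)

div-positive : ∀ {m n} → 1 ≤ m → n ∣ m → 1 ≤ m div n
div-positive {m} {n} 1≤m n∣m with m div n | div*≡ 1≤m n∣m
... | zero  | 0≡m = contradiction (sym 0≡m) (ℕP.m<n⇒n≢0 1≤m)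
... | suc _ | _   = s≤s z≤n

div∣ : ∀ {m n} → 1 ≤ m → n ∣ m → m div n ∣ m
div∣ {m} {n} 1≤m n∣m = divides n (trans (sym (div*≡ 1≤m n∣m)) (ℕP.*-comm (m div n) n))

div-involutive : ∀ {m n} → 1 ≤ m → n ∣ m → m div (m div n) ≡ n
div-involutive {m} {n} 1≤m n∣m =
  div-unique (div-positive 1≤m n∣m) (trans (ℕP.*-comm n (m div n)) (div*≡ 1≤m n∣m))

div-injective : ∀ {m n n′} → 1 ≤ m → n ∣ m → n′ ∣ m → m div n ≡ m div n′ → n ≡ n′
div-injective {m} 1≤m n∣m n′∣m eq =
  trans (sym (div-involutive 1≤m n∣m)) (trans (cong (m div_) eq) (div-involutive 1≤m n′∣m))

div≡1⇒≡ : ∀ {m n} → 1 ≤ m → n ∣ m → m div n ≡ 1 → n ≡ m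
div≡1⇒≡ {m} 1≤m n∣m eq =
  trans (sym (div-involutive 1≤m n∣m)) (trans (cong (m div_) eq) (div-unique (s≤s z≤n) (ℕP.*-identityʳ m)))

module DivisorSum {c ℓ} (S : CommutativeSemiring c ℓ) where

  open CommutativeSemiring S renaming (_*_ to _·_; refl to ≈-refl; sym to ≈-sym; trans to ≈-trans)
  open ListSum S
  open import Relation.Binary.Reasoning.Setoid setoid

  ∑-divisors-complement : ∀ {n} → 1 ≤ n → (f : ℕ → Carrier) →
                          ∑ (divisors n) f ≈ ∑ (divisors n) (λ m → f (n div m))
  ∑-divisors-complement {n} 1≤n f = ∑-reindex ℕP._≟_ (n div_) f (divisors-unique n) (divisors-unique n)
    (λ m∈ → ∈-divisors⁺ 1≤n (div∣ 1≤n (proj₁ (∈-divisors⁻ n m∈))))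
    (λ m∈ m′∈ → div-injective 1≤n (proj₁ (∈-divisors⁻ n m∈)) (proj₁ (∈-divisors⁻ n m′∈)))
    (λ {m} m∈ → let m∣n = proj₁ (∈-divisors⁻ n m∈) in
                inj₂ (n div m , ∈-divisors⁺ 1≤n (div∣ 1≤n m∣n) , div-involutive 1≤n m∣n))

  ∑-divisors-of-divisor : ∀ {m n} → 1 ≤ n → m ∣ n → (f : ℕ → Carrier) →
                          ∑ (divisors m) f ≈ ∑ (divisors n) (λ l → indicator (l ∣? m) · f l)
  ∑-divisors-of-divisor {m} {n} 1≤n m∣n f = ≈-sym (≈-trans
    (∑-reindex ℕP._≟_ (λ l → l) _ (divisors-unique m) (divisors-unique n)
      (λ l∈ → ∈-divisors⁺ 1≤n (∣-trans (proj₁ (∈-divisors⁻ m l∈)) m∣n))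
      (λ _ _ l≡l′ → l≡l′)
      onto)
    (∑-cong (divisors m) (λ l∈ → indicator-*-yes (_ ∣? m) (proj₁ (∈-divisors⁻ m l∈)) _)))
    where
    1≤m = ∣⇒positive 1≤n m∣n
    onto : ∀ {l} → l ∈ divisors n → indicator (l ∣? m) · f l ≈ 0# ⊎ ∃ λ l′ → l′ ∈ divisors m × l′ ≡ l
    onto {l} l∈ with l ∣? m
    ... | yes l∣m = inj₂ (l , ∈-divisors⁺ 1≤m l∣m , refl)
    ... | no  _   = inj₁ (zeroˡ (f l))

  ∑-divisors-multiples : ∀ {l n} → 1 ≤ n → l ∣ n → (f : ℕ → Carrier) →
                         ∑ (divisors n) (λ m → indicator (l ∣? m) · f m) ≈ ∑ (divisors (n div l)) (λ k → f (l * k))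
  ∑-divisors-multiples {l} {n} 1≤n l∣n f = ≈-trans
    (∑-reindex ℕP._≟_ (l *_) _ (divisors-unique (n div l)) (divisors-unique n)
      (λ k∈ → ∈-divisors⁺ 1≤n (subst (l * _ ∣_) l*[n/l]≡n (*-monoʳ-∣ l (proj₁ (∈-divisors⁻ (n div l) k∈)))))
      (λ _ _ → ℕP.*-cancelˡ-≡ _ _ l {{ℕ.>-nonZero 1≤l}})
      onto)
    (∑-cong (divisors (n div l)) (λ {k} _ → indicator-*-yes (l ∣? l * k) (divides k (ℕP.*-comm l k)) _))
    where
    1≤l = ∣⇒positive 1≤n l∣n
    l*[n/l]≡n : l * (n div l) ≡ n
    l*[n/l]≡n = trans (ℕP.*-comm l _) (div*≡ 1≤n l∣n)
    onto : ∀ {m} → m ∈ divisors n → indicator (l ∣? m) · f m ≈ 0# ⊎ ∃ λ k → k ∈ divisors (n div l) × l * k ≡ m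
    onto {m} m∈ with l ∣? m
    ... | no _ = inj₁ (zeroˡ (f m))
    ... | yes (divides k refl) = inj₂ (k , ∈-divisors⁺ (div-positive 1≤n l∣n) k∣n/l , ℕP.*-comm l k)
      where
      k∣n/l : k ∣ n div l
      k∣n/l = divides (n div (k * l)) (div-unique 1≤l n/kl*k*l≡n)
        where
        n/kl*k*l≡n : n div (k * l) * k * l ≡ n
        n/kl*k*l≡n = trans (ℕP.*-assoc (n div (k * l)) k l) (div*≡ 1≤n (proj₁ (∈-divisors⁻ n m∈)))

open ListSum ℕP.+-*-commutativeSemiring

open DivisorSum ℕP.+-*-commutativeSemiring using (∑-divisors-complement)

-- ℕ's _+_ enters scope only here, so as not to clash with the semiring's _+_ in the modules above.
open import Data.Nat using (_+_)

length-filter : ∀ {P : A → Set p} (P? : ∀ x → Dec (P x)) xs → length (filter P? xs) ≡ ∑ xs (λ x → indicator (P? x))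
length-filter P? []       = refl
length-filter P? (x ∷ xs) with P? x
... | yes _ = cong suc (length-filter P? xs)
... | no  _ = length-filter P? xs

∑-const : ∀ (xs : List A) k → ∑ xs (λ _ → k) ≡ length xs * k
∑-const []       k = refl
∑-const (x ∷ xs) k = cong (k ℕ.+_) (∑-const xs k)

allTuples-unique : ∀ m d → Unique (allTuples m d)
allTuples-unique m zero    = All.[] ∷ []
allTuples-unique m (suc d) = Unique.concat⁺
  (All.map⁺ (All.universal (λ _ → Unique.map⁺ VP.∷-injectiveʳ (allTuples-unique m d)) (allFin m)))
  (AllPairs.map⁺ (AllPairs.map disjoint (Unique.allFin⁺ m)))
  where
  disjoint : ∀ {a b : Fin m} → a ≢ b →
             ∀ {v} → ¬ (v ∈ L.map (a ∷_) (allTuples m d) × v ∈ L.map (b ∷_) (allTuples m d))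
  disjoint a≢b (va , vb) with ∈-map⁻ _ va | ∈-map⁻ _ vb
  ... | _ , _ , refl | _ , _ , e = a≢b (VP.∷-injectiveˡ e)

∈-allTuples : ∀ {m d} (x : Vec (Fin m) d) → x ∈ allTuples m d
∈-allTuples []      = here refl
∈-allTuples (a ∷ x) = ∈-concatMap⁺ _ (Any.map (λ { refl → ∈-map⁺ (a ∷_) (∈-allTuples x) }) (∈-allFin a))

[m+n]%o≡m%o⇒o∣n : ∀ m n o .{{_ : NonZero o}} → (m + n) % o ≡ m % o → o ∣ n
[m+n]%o≡m%o⇒o∣n m n o eq = ∣m+n∣m⇒∣n (divides ((m + n) / o) split) (divides (m / o) refl)
  where
  split : m / o * o + n ≡ (m + n) / o * o
  split = ℕP.+-cancelˡ-≡ (m % o) _ _ (begin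
    m % o + (m / o * o + n)   ≡⟨ sym (ℕP.+-assoc (m % o) _ n) ⟩
    m % o + m / o * o + n     ≡⟨ cong (_+ n) (sym (m≡m%n+[m/n]*n m o)) ⟩
    m + n                     ≡⟨ m≡m%n+[m/n]*n (m + n) o ⟩
    (m + n) % o + (m + n) / o * o ≡⟨ cong (_+ (m + n) / o * o) eq ⟩
    m % o + (m + n) / o * o   ∎)
    where open ≡.≡-Reasoning

<∧∣⇒≡0 : ∀ {k n} → k < n → n ∣ k → k ≡ 0
<∧∣⇒≡0 {zero}  _   _   = refl
<∧∣⇒≡0 {suc k} k<n n∣k = contradiction (∣⇒≤ n∣k) (ℕP.<⇒≱ k<n)

toℕ-mod : ∀ m n .{{_ : NonZero n}} → toℕ (m mod n) ≡ m % n
toℕ-mod m n = FP.toℕ-fromℕ< _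

mod-fixes⇔ : ∀ {n} k (a : Fin (suc n)) → (suc k * toℕ a) mod suc n ≡ a ⇔ suc n ∣ k * toℕ a
mod-fixes⇔ {n} k a = mk⇔ to from
  where
  a%n≡a : toℕ a % suc n ≡ toℕ a
  a%n≡a = m<n⇒m%n≡m (FP.toℕ<n a)
  to : (suc k * toℕ a) mod suc n ≡ a → suc n ∣ k * toℕ a
  to eq = [m+n]%o≡m%o⇒o∣n (toℕ a) (k * toℕ a) (suc n)
    (trans (sym (toℕ-mod (suc k * toℕ a) (suc n))) (trans (cong toℕ eq) (sym a%n≡a)))
  from : suc n ∣ k * toℕ a → (suc k * toℕ a) mod suc n ≡ a
  from n∣ka = FP.toℕ-injective (trans (toℕ-mod (suc k * toℕ a) (suc n)) (trans (%-remove-+ʳ (toℕ a) n∣ka) a%n≡a))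

gcd≢0 : ∀ c n .{{_ : NonZero n}} → NonZero (gcd c n)
gcd≢0 c n = ℕ.≢-nonZero (gcd[m,n]≢0 c n (inj₂ (ℕ.≢-nonZero⁻¹ n)))

-- c / gcd c n and n / gcd c n are coprime.
∣*⇔div-gcd∣ : ∀ c n .{{_ : NonZero n}} a → n ∣ c * a ⇔ (n div gcd c n) ∣ a
∣*⇔div-gcd∣ c n a = mk⇔ to from
  where
  g = gcd c n
  instance
    g≢0 : NonZero g
    g≢0 = gcd≢0 c n
  n/g*g≡n : n / g * g ≡ n
  n/g*g≡n = m/n*n≡m (gcd[m,n]∣n c n)
  c/g*g≡c : c / g * g ≡ c
  c/g*g≡c = m/n*n≡m (gcd[m,n]∣m c n)
  to : n ∣ c * a → (n div g) ∣ a
  to n∣ca = subst (_∣ a) (sym (div≡/ n g)) (coprime-divisor (Coprime.sym (coprime-/gcd c n)) n/g∣c/g*a)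
    where
    n/g∣c/g*a : n / g ∣ c / g * a
    n/g∣c/g*a = *-cancelʳ-∣ g (subst₂ _∣_ (sym n/g*g≡n)
      (trans (cong (_* a) (sym c/g*g≡c)) (rearrange (c / g) g a)) n∣ca)
      where
      rearrange : ∀ x y z → x * y * z ≡ x * z * y
      rearrange = solve-∀
  from : (n div g) ∣ a → n ∣ c * a
  from n/g∣a = subst₂ _∣_ n/g*g≡n (ℕP.*-comm a c)
    (*-pres-∣ (subst (_∣ a) (div≡/ n g) n/g∣a) (gcd[m,n]∣m c n))

∣gcdVec⇔ : ∀ {m d} c (x : Vec (Fin m) d) → c ∣ gcdVec m x ⇔ (c ∣ m × VAll.All (λ a → c ∣ toℕ a) x)
∣gcdVec⇔ c x = mk⇔ (to x) (λ (c∣m , c∣x) → from x c∣m c∣x)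
  where
  to : ∀ {m d} (x : Vec (Fin m) d) → c ∣ gcdVec m x → c ∣ m × VAll.All (λ a → c ∣ toℕ a) x
  to []      c∣g = c∣g , VAll.[]
  to (a ∷ x) c∣g with to x (∣-trans c∣g (gcd[m,n]∣n (toℕ a) (gcdVec _ x)))
  ... | c∣m , c∣x = c∣m , ∣-trans c∣g (gcd[m,n]∣m (toℕ a) (gcdVec _ x)) VAll.∷ c∣x
  from : ∀ {m d} (x : Vec (Fin m) d) → c ∣ m → VAll.All (λ a → c ∣ toℕ a) x → c ∣ gcdVec m x
  from []      c∣m VAll.[]          = c∣m
  from (a ∷ x) c∣m (c∣a VAll.∷ c∣x) = gcd-greatest c∣a (from x c∣m c∣x)

gcdVec∣ : ∀ {m d} (x : Vec (Fin m) d) → gcdVec m x ∣ m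
gcdVec∣ x = proj₁ (Equivalence.to (∣gcdVec⇔ _ x) ∣-refl)

map-fixes⇔ : ∀ {a} {A : Set a} {d} (f : A → A) (x : Vec A d) → V.map f x ≡ x ⇔ VAll.All (λ a → f a ≡ a) x
map-fixes⇔ f x = mk⇔ (to x) (from x)
  where
  to : ∀ {d} (x : Vec _ d) → V.map f x ≡ x → VAll.All (λ a → f a ≡ a) x
  to []      _  = VAll.[]
  to (a ∷ x) eq = VP.∷-injectiveˡ eq VAll.∷ to x (VP.∷-injectiveʳ eq)
  from : ∀ {d} (x : Vec _ d) → VAll.All (λ a → f a ≡ a) x → V.map f x ≡ x
  from []      VAll.[]        = refl
  from (a ∷ x) (e VAll.∷ es) = cong₂ _∷_ e (from x es)

act-fixes⇔ : ∀ {n d} k (x : Vec (Fin (suc n)) d) →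
             act (suc k) x ≡ x ⇔ (suc n div gcd k (suc n)) ∣ gcdVec (suc n) x
act-fixes⇔ {n} k x = mk⇔ to from
  where
  N = suc n
  to : act (suc k) x ≡ x → (N div gcd k N) ∣ gcdVec N x
  to fixed = Equivalence.from (∣gcdVec⇔ _ x)
    ( div∣ (s≤s z≤n) (gcd[m,n]∣n k N)
    , VAll.map (λ {a} → Equivalence.to (∣*⇔div-gcd∣ k N (toℕ a)) ∘ Equivalence.to (mod-fixes⇔ k a))
               (Equivalence.to (map-fixes⇔ _ x) fixed))
  from : (N div gcd k N) ∣ gcdVec N x → act (suc k) x ≡ x
  from q∣g = Equivalence.from (map-fixes⇔ _ x)
    (VAll.map (λ {a} → Equivalence.from (mod-fixes⇔ k a) ∘ Equivalence.from (∣*⇔div-gcd∣ k N (toℕ a)))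
              (proj₂ (Equivalence.to (∣gcdVec⇔ _ x) q∣g)))

inStab⇔ : ∀ {n d} k (x : Vec (Fin n) d) → IsAut n k →
          InStab k x ⇔ (n div gcd (k ∸ 1) n) ∣ gcdVec n x
inStab⇔ {zero}  k       x (_ , () , _)
inStab⇔ {suc n} zero    x (() , _)
inStab⇔ {suc n} (suc k) x aut = mk⇔ (Equivalence.to (act-fixes⇔ k x) ∘ proj₂)
                                     (λ q∣g → aut , Equivalence.from (act-fixes⇔ k x) q∣g)

inStab⇔≡1 : ∀ {n d} k (x : Vec (Fin n) d) → IsAut n k → gcdVec n x ≡ 1 → InStab k x ⇔ k ≡ 1
inStab⇔≡1 {zero}  k       x (_ , () , _)
inStab⇔≡1 {suc n} zero    x (() , _)
inStab⇔≡1 {suc n} (suc k) x aut g≡1 = mk⇔ to from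
  where
  N = suc n
  to : InStab (suc k) x → suc k ≡ 1
  to stab = cong suc (<∧∣⇒≡0 (ℕP.<-trans (ℕP.n<1+n k) (proj₁ (proj₂ aut))) N∣k)
    where
    gcd≡N : gcd k N ≡ N
    gcd≡N = div≡1⇒≡ (s≤s z≤n) (gcd[m,n]∣n k N)
      (∣1⇒≡1 (subst (_ ∣_) g≡1 (Equivalence.to (inStab⇔ (suc k) x aut) stab)))
    N∣k : N ∣ k
    N∣k = subst (_∣ k) gcd≡N (gcd[m,n]∣m k N)
  from : suc k ≡ 1 → InStab (suc k) x
  from refl = Equivalence.from (inStab⇔ 1 x aut)
    (subst (_∣ gcdVec N x) (sym (trans (cong (N div_) (gcd-identityˡ N)) (div-unique (s≤s z≤n) (ℕP.*-identityˡ N)))) (1∣ _))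

module UnitAction (n : ℕ) (1<N : 1 < suc n) where

  N : ℕ
  N = suc n

  1%N≡1 : 1 % N ≡ 1
  1%N≡1 = m<n⇒m%n≡m 1<N

  %-*-congˡ : ∀ x y z → x % N ≡ y % N → (x * z) % N ≡ (y * z) % N
  %-*-congˡ x y z eq = trans (%-distribˡ-* x z N)
    (trans (cong (λ t → (t * (z % N)) % N) eq) (sym (%-distribˡ-* y z N)))

  %-*-congʳ : ∀ x y z → x % N ≡ y % N → (z * x) % N ≡ (z * y) % N
  %-*-congʳ x y z eq =
    trans (cong (_% N) (ℕP.*-comm z x)) (trans (%-*-congˡ x y z eq) (cong (_% N) (ℕP.*-comm y z)))

  *-identity-% : ∀ x y → x % N ≡ 1 → (y * x) % N ≡ y % N
  *-identity-% x y x≡1 =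
    trans (%-*-congʳ x 1 y (trans x≡1 (sym 1%N≡1))) (cong (_% N) (ℕP.*-identityʳ y))

  scale : ℕ → Fin N → Fin N
  scale k a = (k * toℕ a) mod N

  toℕ-scale : ∀ k a → toℕ (scale k a) ≡ (k * toℕ a) % N
  toℕ-scale k a = toℕ-mod (k * toℕ a) N

  scale-cong : ∀ j k → j % N ≡ k % N → ∀ a → scale j a ≡ scale k a
  scale-cong j k eq a = FP.toℕ-injective
    (trans (toℕ-scale j a) (trans (%-*-congˡ j k (toℕ a) eq) (sym (toℕ-scale k a))))

  scale-∘ : ∀ j k a → scale j (scale k a) ≡ scale (j * k) a
  scale-∘ j k a = FP.toℕ-injective (begin
    toℕ (scale j (scale k a))  ≡⟨ toℕ-scale j (scale k a) ⟩
    (j * toℕ (scale k a)) % N  ≡⟨ %-*-congʳ (toℕ (scale k a)) (k * toℕ a) j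
                                    (trans (cong (_% N) (toℕ-scale k a)) (m%n%n≡m%n (k * toℕ a) N)) ⟩
    (j * (k * toℕ a)) % N      ≡⟨ cong (_% N) (sym (ℕP.*-assoc j k (toℕ a))) ⟩
    (j * k * toℕ a) % N        ≡⟨ sym (toℕ-scale (j * k) a) ⟩
    toℕ (scale (j * k) a)      ∎)
    where open ≡.≡-Reasoning

  scale-1 : ∀ a → scale 1 a ≡ a
  scale-1 a = FP.toℕ-injective
    (trans (toℕ-scale 1 a) (trans (cong (_% N) (ℕP.*-identityˡ (toℕ a))) (m<n⇒m%n≡m (FP.toℕ<n a))))

  act-cong : ∀ {d} j k → j % N ≡ k % N → (x : Vec (Fin N) d) → act j x ≡ act k x
  act-cong j k eq = VP.map-cong (scale-cong j k eq)

  act-∘ : ∀ {d} j k (x : Vec (Fin N) d) → act j (act k x) ≡ act (j * k) x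
  act-∘ j k x = trans (sym (VP.map-∘ (scale j) (scale k) x)) (VP.map-cong (scale-∘ j k) x)

  act-1 : ∀ {d} (x : Vec (Fin N) d) → act 1 x ≡ x
  act-1 x = trans (VP.map-cong scale-1 x) (VP.map-id x)

  act-inverse : ∀ {d} j k → (j * k) % N ≡ 1 → (x : Vec (Fin N) d) → act j (act k x) ≡ x
  act-inverse j k jk≡1 x =
    trans (act-∘ j k x) (trans (act-cong (j * k) 1 (trans jk≡1 (sym 1%N≡1)) x) (act-1 x))

  isAut⁺ : ∀ {k} → k < N → Coprime k N → IsAut N k
  isAut⁺ {zero}  _   0⊥N = contradiction (sym (0-coprimeTo-m⇒m≡1 0⊥N)) (ℕP.<⇒≢ 1<N)
  isAut⁺ {suc k} k<N k⊥N = s≤s z≤n , k<N , k⊥N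

  isAut-1 : IsAut N 1
  isAut-1 = isAut⁺ 1<N (1-coprimeTo N)

  coprime-* : ∀ {j k} → Coprime j N → Coprime k N → Coprime (j * k) N
  coprime-* {j} {k} j⊥N k⊥N {d} (d∣jk , d∣N) = k⊥N (coprime-divisor d⊥j d∣jk , d∣N)
    where
    d⊥j : Coprime d j
    d⊥j (c∣d , c∣j) = j⊥N (c∣j , ∣-trans c∣d d∣N)

  isAut-* : ∀ {j k} → IsAut N j → IsAut N k → IsAut N ((j * k) % N)
  isAut-* {j} {k} (_ , _ , j⊥N) (_ , _ , k⊥N) = isAut⁺ (m%n<n (j * k) N) %-coprime
    where
    %-coprime : Coprime ((j * k) % N) N
    %-coprime (d∣jk% , d∣N) = coprime-* j⊥N k⊥N (∣n∣m%n⇒∣m d∣N d∣jk% , d∣N)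

  inverse⇒coprime : ∀ {j k} → (j * k) % N ≡ 1 → Coprime j N
  inverse⇒coprime {j} {k} jk≡1 {d} (d∣j , d∣N) =
    ∣1⇒≡1 (∣m+n∣m⇒∣n (subst (d ∣_) jk≡qN+1 (∣m⇒∣m*n k d∣j)) (∣n⇒∣m*n ((j * k) / N) d∣N))
    where
    jk≡qN+1 : j * k ≡ (j * k) / N * N + 1
    jk≡qN+1 = trans (m≡m%n+[m/n]*n (j * k) N) (trans (cong (_+ (j * k) / N * N) jk≡1) (ℕP.+-comm 1 _))

  mod-inverse : ∀ {k} → Coprime k N → ∃ λ j → (j * k) % N ≡ 1
  mod-inverse {k} k⊥N with coprime-Bézout k⊥N
  ... | Bézout.+- x y 1+yN≡xk = x , (begin
    (x * k) % N       ≡⟨ cong (_% N) (sym 1+yN≡xk) ⟩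
    (1 + y * N) % N   ≡⟨ %-remove-+ʳ 1 {y * N} (divides y refl) ⟩
    1 % N             ≡⟨ 1%N≡1 ⟩
    1                 ∎)
    where open ≡.≡-Reasoning
  ... | Bézout.-+ x y 1+xk≡yN = x * n , (begin
    (x * n * k) % N              ≡⟨ sym (%-remove-+ʳ (x * n * k) {y * N} (divides y refl)) ⟩
    (x * n * k + y * N) % N      ≡⟨ cong (λ t → (x * n * k + t) % N) (sym 1+xk≡yN) ⟩
    (x * n * k + (1 + x * k)) % N ≡⟨ cong (_% N) (expand x n k) ⟩
    (1 + x * k * N) % N          ≡⟨ %-remove-+ʳ 1 {x * k * N} (divides (x * k) refl) ⟩
    1 % N                        ≡⟨ 1%N≡1 ⟩
    1                            ∎)
    where
    open ≡.≡-Reasoning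
    expand : ∀ x n k → x * n * k + (1 + x * k) ≡ 1 + x * k * suc n
    expand = solve-∀

  isAut-inverse : ∀ {k} → IsAut N k → ∃ λ j → IsAut N j × (j * k) % N ≡ 1
  isAut-inverse {k} (_ , _ , k⊥N) with mod-inverse k⊥N
  ... | j , jk≡1 = j % N , isAut⁺ (m%n<n j N) (inverse⇒coprime j%N*k≡1) , j%N*k≡1
    where
    j%N*k≡1 : (j % N * k) % N ≡ 1
    j%N*k≡1 = trans (%-*-congˡ (j % N) j k (m%n%n≡m%n j N)) jk≡1

  sameOrbit-refl : ∀ {d} (x : Vec (Fin N) d) → SameOrbit x x
  sameOrbit-refl x = 1 , isAut-1 , act-1 x

  sameOrbit-sym : ∀ {d} {x y : Vec (Fin N) d} → SameOrbit x y → SameOrbit y x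
  sameOrbit-sym {x = x} (k , k-aut , refl) with isAut-inverse k-aut
  ... | j , j-aut , jk≡1 = j , j-aut , act-inverse j k jk≡1 x

  sameOrbit-trans : ∀ {d} {x y z : Vec (Fin N) d} → SameOrbit x y → SameOrbit y z → SameOrbit x z
  sameOrbit-trans {x = x} (k , k-aut , refl) (j , j-aut , refl) =
    (j * k) % N , isAut-* j-aut k-aut , trans (act-cong ((j * k) % N) (j * k) (m%n%n≡m%n (j * k) N) x) (sym (act-∘ j k x))

  sameOrbit? : ∀ {d} (x y : Vec (Fin N) d) → Dec (SameOrbit x y)
  sameOrbit? x y = Dec.map′ (λ { (k , _ , p) → k , p }) (λ { (k , p) → k , proj₁ (proj₂ (proj₁ p)) , p })
    (ℕP.anyUpTo? (λ k → isAut? k Dec.×-dec VP.≡-dec FP._≟_ (act k x) y) N)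
    where
    isAut? : ∀ k → Dec (IsAut N k)
    isAut? k = (1 ℕP.≤? k) Dec.×-dec (k ℕP.<? N) Dec.×-dec coprime? k N

  subsetSum-act : ∀ {d} j (S : Subset d) (y : Vec (Fin N) d) →
                  subsetSum S (act j y) % N ≡ (j * subsetSum S y) % N
  subsetSum-act j []            []      = cong (_% N) (sym (ℕP.*-zeroʳ j))
  subsetSum-act j (outside ∷ S) (a ∷ y) = subsetSum-act j S y
  subsetSum-act j (inside ∷ S)  (a ∷ y) = begin
    (toℕ (scale j a) + subsetSum S (act j y)) % N
      ≡⟨ %-distribˡ-+ (toℕ (scale j a)) _ N ⟩
    (toℕ (scale j a) % N + subsetSum S (act j y) % N) % N
      ≡⟨ cong₂ (λ u v → (u + v) % N)
               (trans (cong (_% N) (toℕ-scale j a)) (m%n%n≡m%n (j * toℕ a) N)) (subsetSum-act j S y) ⟩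
    ((j * toℕ a) % N + (j * subsetSum S y) % N) % N
      ≡⟨ sym (%-distribˡ-+ (j * toℕ a) _ N) ⟩
    (j * toℕ a + j * subsetSum S y) % N
      ≡⟨ cong (_% N) (sym (ℕP.*-distribˡ-+ j (toℕ a) (subsetSum S y))) ⟩
    (j * (toℕ a + subsetSum S y)) % N ∎
    where open ≡.≡-Reasoning

  zeroSumSubset-act : ∀ {d} j (y : Vec (Fin N) d) S → ZeroSumSubset N y S → ZeroSumSubset N (act j y) S
  zeroSumSubset-act j y S (S≢∅ , N∣Σ) =
    S≢∅ , m%n≡0⇒n∣m _ N (trans (subsetSum-act j S y) (n∣m⇒m%n≡0 _ N (∣n⇒∣m*n j N∣Σ)))

  gcdVec-act : ∀ {d} j (y : Vec (Fin N) d) → gcdVec N y ∣ gcdVec N (act j y)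
  gcdVec-act j y with Equivalence.to (∣gcdVec⇔ (gcdVec N y) y) ∣-refl
  ... | g∣N , g∣y = Equivalence.from (∣gcdVec⇔ _ (act j y)) (g∣N , go y g∣y)
    where
    go : ∀ {d} (z : Vec (Fin N) d) → VAll.All (λ a → gcdVec N y ∣ toℕ a) z →
         VAll.All (λ a → gcdVec N y ∣ toℕ a) (act j z)
    go []      VAll.[]          = VAll.[]
    go (a ∷ z) (g∣a VAll.∷ g∣z) =
      subst (gcdVec N y ∣_) (sym (toℕ-scale j a)) (%-presˡ-∣ (∣n⇒∣m*n j g∣a) g∣N) VAll.∷ go z g∣z

  irreducible-act : ∀ {d k} (x : Vec (Fin N) d) → IsAut N k → Irreducible N x → Irreducible N (act k x)
  irreducible-act {k = k} x k-aut (x-free , gx≡1) with isAut-inverse k-aut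
  ... | j , _ , jk≡1 = kx-free , ∣1⇒≡1 (subst (gcdVec N (act k x) ∣_) gx≡1′ (gcdVec-act j (act k x)))
    where
    gx≡1′ : gcdVec N (act j (act k x)) ≡ 1
    gx≡1′ = trans (cong (gcdVec N) (act-inverse j k jk≡1 x)) gx≡1
    kx-free : ZeroSumFree N (act k x)
    kx-free (S , zs) = x-free (S , subst (λ z → ZeroSumSubset N z S) (act-inverse j k jk≡1 x) (zeroSumSubset-act j _ S zs))

  -- j k stabilises r for the inverse j of k′, so it is 1 by part (a).
  act-injective : ∀ {d k k′} (r : Vec (Fin N) d) → Irreducible N r → IsAut N k → IsAut N k′ →
                  act k r ≡ act k′ r → k ≡ k′
  act-injective {k = k} {k′} r (_ , gr≡1) k-aut k′-aut kr≡k′r with isAut-inverse k′-aut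
  ... | j , j-aut , jk′≡1 = begin
    k                    ≡⟨ sym (m<n⇒m%n≡m (proj₁ (proj₂ k-aut))) ⟩
    k % N                ≡⟨ sym (*-identity-% (j * k′) k jk′≡1) ⟩
    (k * (j * k′)) % N   ≡⟨ cong (_% N) (swap k j k′) ⟩
    (k′ * (j * k)) % N   ≡⟨ *-identity-% (j * k) k′ jk≡1 ⟩
    k′ % N               ≡⟨ m<n⇒m%n≡m (proj₁ (proj₂ k′-aut)) ⟩
    k′                   ∎
    where
    open ≡.≡-Reasoning
    swap : ∀ k j k′ → k * (j * k′) ≡ k′ * (j * k)
    swap = solve-∀
    stabilises : act ((j * k) % N) r ≡ r
    stabilises = trans (act-cong ((j * k) % N) (j * k) (m%n%n≡m%n (j * k) N) r)
      (trans (sym (act-∘ j k r)) (trans (cong (act j) kr≡k′r) (act-inverse j k′ jk′≡1 r)))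
    jk≡1 : (j * k) % N ≡ 1
    jk≡1 = Equivalence.to (inStab⇔≡1 _ r (isAut-* j-aut k-aut) gr≡1) (isAut-* j-aut k-aut , stabilises)

  units : List ℕ
  units = filter (λ k → coprime? k N) (oneTo N)

  units-unique : Unique units
  units-unique = Unique.filter⁺ (λ k → coprime? k N) (oneTo-unique N)

  ∈-units⁺ : ∀ {k} → IsAut N k → k ∈ units
  ∈-units⁺ (1≤k , k<N , k⊥N) = ∈-filter⁺ (λ k → coprime? k N) (∈-oneTo⁺ 1≤k (ℕP.<⇒≤ k<N)) k⊥N

  ∈-units⁻ : ∀ {k} → k ∈ units → IsAut N k
  ∈-units⁻ {k} k∈ with ∈-filter⁻ (λ k → coprime? k N) {xs = oneTo N} k∈
  ... | k∈oneTo , k⊥N = isAut⁺ (ℕP.≤∧≢⇒< (proj₂ (∈-oneTo⁻ N k∈oneTo)) k≢N) k⊥N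
    where
    k≢N : k ≢ N
    k≢N refl = ℕP.<⇒≢ 1<N (sym (k⊥N (∣-refl , ∣-refl)))

  φ-positive : 1 ≤ φ N
  φ-positive = ∈-length (∈-units⁺ isAut-1)

  orbit-size : ∀ {d} (r : Vec (Fin N) d) → Irreducible N r →
               ∑ (allTuples N d) (λ x → indicator (sameOrbit? x r)) ≡ φ N
  orbit-size {d} r r-irr = begin
    ∑ (allTuples N d) inOrbit
      ≡⟨ ∑-reindex (VP.≡-dec FP._≟_) (λ k → act k r) inOrbit units-unique (allTuples-unique N d)
                   (λ _ → ∈-allTuples _) injective onto ⟩
    ∑ units (λ k → inOrbit (act k r))
      ≡⟨ ∑-cong units (λ k∈ → indicator-yes (sameOrbit? _ r) (sameOrbit-sym (_ , ∈-units⁻ k∈ , refl))) ⟩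
    ∑ units (λ _ → 1)
      ≡⟨ ∑-const units 1 ⟩
    length units * 1
      ≡⟨ ℕP.*-identityʳ _ ⟩
    φ N ∎
    where
    open ≡.≡-Reasoning
    inOrbit : Vec (Fin N) d → ℕ
    inOrbit x = indicator (sameOrbit? x r)
    injective : ∀ {k k′} → k ∈ units → k′ ∈ units → act k r ≡ act k′ r → k ≡ k′
    injective k∈ k′∈ = act-injective r r-irr (∈-units⁻ k∈) (∈-units⁻ k′∈)
    onto : ∀ {x} → x ∈ allTuples N d → inOrbit x ≡ 0 ⊎ ∃ λ k → k ∈ units × act k r ≡ x
    onto {x} _ with sameOrbit? x r
    ... | no _ = inj₁ refl
    ... | yes x~r with sameOrbit-sym x~r
    ...   | k , k-aut , kr≡x = inj₂ (k , ∈-units⁺ k-aut , kr≡x)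

  representatives : ∀ d → List (Vec (Fin N) d)
  representatives d = deduplicate sameOrbit? (filter (irreducible? N) (allTuples N d))

  orbitTransversal : ∀ d → OrbitTransversal N d (representatives d)
  orbitTransversal d =
      All.deduplicate⁺ sameOrbit? (All.all-filter (irreducible? N) (allTuples N d))
    , (λ x x-irr → Any.deduplicate⁺ sameOrbit? (λ s~r x~r → sameOrbit-trans x~r (sameOrbit-sym s~r))
        (Any.map (λ { refl → sameOrbit-refl x }) (∈-filter⁺ (irreducible? N) (∈-allTuples x) x-irr)))
    , deduplicate-apart sameOrbit? (filter (irreducible? N) (allTuples N d))

  module Transversal {d} {R : List (Vec (Fin N) d)} (transversal : OrbitTransversal N d R) where

    private
      R-irreducible = proj₁ transversal
      covers        = proj₁ (proj₂ transversal)
      apart         = proj₂ (proj₂ transversal)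

    unique : Unique R
    unique = AllPairs.map (λ ¬r~s r≡s → ¬r~s (subst (SameOrbit _) r≡s (sameOrbit-refl _))) apart

    -- Each irreducible tuple lies in the orbit of exactly one representative, a reducible one in none.
    indicator-irreducible : ∀ x → indicator (irreducible? N x) ≡ ∑ R (λ r → indicator (sameOrbit? x r))
    indicator-irreducible x with irreducible? N x
    ... | yes x-irr with find (covers x x-irr)
    ...   | r₀ , r₀∈ , x~r₀ = sym (trans (∑-single unique r₀∈ other) (indicator-yes (sameOrbit? x r₀) x~r₀))
      where
      other : ∀ {r} → r ∈ R → r ≢ r₀ → indicator (sameOrbit? x r) ≡ 0
      other {r} r∈ r≢r₀ = indicator-no (sameOrbit? x r) λ x~r →
        let r~r₀ = sameOrbit-trans (sameOrbit-sym x~r) x~r₀ in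
        [ (λ ¬r~r₀ → ¬r~r₀ r~r₀) , (λ ¬r₀~r → ¬r₀~r (sameOrbit-sym r~r₀)) ]
          (allPairs-∈ apart r∈ r₀∈ r≢r₀)
    indicator-irreducible x | no x-red = sym (∑-zero R λ {r} r∈ → indicator-no (sameOrbit? x r) λ x~r →
      let k , k-aut , kr≡x = sameOrbit-sym x~r in
      x-red (subst (Irreducible N) kr≡x (irreducible-act r k-aut (All.lookup R-irreducible r∈))))

    length*φ≡β : length R * φ N ≡ β N d
    length*φ≡β = sym (begin
      β N d
        ≡⟨ length-filter (irreducible? N) (allTuples N d) ⟩
      ∑ (allTuples N d) (λ x → indicator (irreducible? N x))
        ≡⟨ ∑-cong (allTuples N d) (λ {x} _ → indicator-irreducible x) ⟩
      ∑ (allTuples N d) (λ x → ∑ R (λ r → indicator (sameOrbit? x r)))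
        ≡⟨ ∑-comm (allTuples N d) R _ ⟩
      ∑ R (λ r → ∑ (allTuples N d) (λ x → indicator (sameOrbit? x r)))
        ≡⟨ ∑-cong R (λ r∈ → orbit-size _ (All.lookup R-irreducible r∈)) ⟩
      ∑ R (λ _ → φ N)
        ≡⟨ ∑-const R (φ N) ⟩
      length R * φ N ∎)
      where open ≡.≡-Reasoning

orbit-count : ∀ n d → 1 < n →
  (∃ λ (R : List (Vec (Fin n) d)) → OrbitTransversal n d R)
  × ((R : List (Vec (Fin n) d)) → OrbitTransversal n d R → length R ≡ β n d div φ n)
  × (φ n ∣ β n d)
orbit-count (suc n) d 1<N =
    (representatives d , orbitTransversal d)
  , (λ R transversal → sym (div-unique φ-positive (Transversal.length*φ≡β transversal)))
  , divides (length (representatives d)) (sym (Transversal.length*φ≡β (orbitTransversal d)))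
  where open UnitAction n 1<N

module Scaling {M q g : ℕ} (q*g≡M : q * g ≡ M) (1≤g : 1 ≤ g) where

  instance
    g≢0 : NonZero g
    g≢0 = ℕ.>-nonZero 1≤g

  scaleUp : Fin q → Fin M
  scaleUp a = F.fromℕ< (subst (toℕ a * g <_) q*g≡M (ℕP.*-monoˡ-< g (FP.toℕ<n a)))

  toℕ-scaleUp : ∀ a → toℕ (scaleUp a) ≡ toℕ a * g
  toℕ-scaleUp a = FP.toℕ-fromℕ< _

  subsetSum-scaleUp : ∀ {d} (S : Subset d) (y : Vec (Fin q) d) →
                      subsetSum S (V.map scaleUp y) ≡ subsetSum S y * g
  subsetSum-scaleUp []            []      = refl
  subsetSum-scaleUp (outside ∷ S) (a ∷ y) = subsetSum-scaleUp S y
  subsetSum-scaleUp (inside ∷ S)  (a ∷ y) =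
    trans (cong₂ _+_ (toℕ-scaleUp a) (subsetSum-scaleUp S y)) (sym (ℕP.*-distribʳ-+ g (toℕ a) (subsetSum S y)))

  zeroSumSubset⇔ : ∀ {d} (y : Vec (Fin q) d) S → ZeroSumSubset M (V.map scaleUp y) S ⇔ ZeroSumSubset q y S
  zeroSumSubset⇔ y S = mk⇔
    (λ (S≢∅ , M∣) → S≢∅ , *-cancelʳ-∣ g (subst₂ _∣_ (sym q*g≡M) (subsetSum-scaleUp S y) M∣))
    (λ (S≢∅ , q∣) → S≢∅ , subst₂ _∣_ q*g≡M (sym (subsetSum-scaleUp S y)) (*-monoˡ-∣ g q∣))

  zeroSumFree⇔ : ∀ {d} (y : Vec (Fin q) d) → ZeroSumFree M (V.map scaleUp y) ⇔ ZeroSumFree q y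
  zeroSumFree⇔ y = mk⇔
    (λ free (S , zs) → free (S , Equivalence.from (zeroSumSubset⇔ y S) zs))
    (λ free (S , zs) → free (S , Equivalence.to (zeroSumSubset⇔ y S) zs))

  gcdVec-scaleUp : ∀ {d} (y : Vec (Fin q) d) → gcdVec M (V.map scaleUp y) ≡ gcdVec q y * g
  gcdVec-scaleUp []      = sym q*g≡M
  gcdVec-scaleUp (a ∷ y) = begin
    gcd (toℕ (scaleUp a)) (gcdVec M (V.map scaleUp y)) ≡⟨ cong₂ gcd (toℕ-scaleUp a) (gcdVec-scaleUp y) ⟩
    gcd (toℕ a * g) (gcdVec q y * g)                   ≡⟨ cong₂ gcd (ℕP.*-comm (toℕ a) g) (ℕP.*-comm (gcdVec q y) g) ⟩
    gcd (g * toℕ a) (g * gcdVec q y)                   ≡⟨ sym (c*gcd[m,n]≡gcd[cm,cn] g (toℕ a) (gcdVec q y)) ⟩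
    g * gcd (toℕ a) (gcdVec q y)                       ≡⟨ ℕP.*-comm g _ ⟩
    gcd (toℕ a) (gcdVec q y) * g                       ∎
    where open ≡.≡-Reasoning

  irreducible⇔ : ∀ {d} (y : Vec (Fin q) d) →
                 (ZeroSumFree M (V.map scaleUp y) × gcdVec M (V.map scaleUp y) ≡ g) ⇔ Irreducible q y
  irreducible⇔ y = mk⇔
    (λ (free , gcd≡g) → Equivalence.to (zeroSumFree⇔ y) free
                      , ℕP.*-cancelʳ-≡ _ 1 g (trans (sym (gcdVec-scaleUp y)) (trans gcd≡g (sym (ℕP.*-identityˡ g)))))
    (λ (free , gcd≡1) → Equivalence.from (zeroSumFree⇔ y) free
                      , trans (gcdVec-scaleUp y) (trans (cong (_* g) gcd≡1) (ℕP.*-identityˡ g)))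

  scaleUp-injective : ∀ {a b} → scaleUp a ≡ scaleUp b → a ≡ b
  scaleUp-injective {a} {b} eq = FP.toℕ-injective
    (ℕP.*-cancelʳ-≡ (toℕ a) (toℕ b) g (trans (sym (toℕ-scaleUp a)) (trans (cong toℕ eq) (toℕ-scaleUp b))))

  scaleUp-surjective : ∀ {d} (x : Vec (Fin M) d) → VAll.All (λ a → g ∣ toℕ a) x →
                       ∃ λ y → V.map scaleUp y ≡ x
  scaleUp-surjective []      VAll.[]          = [] , refl
  scaleUp-surjective (a ∷ x) (g∣a VAll.∷ g∣x) with scaleUp-surjective x g∣x
  ... | y , y↦x = F.fromℕ< a/g<q ∷ y , cong₂ _∷_ (FP.toℕ-injective a/g↦a) y↦x
    where
    a/g<q : toℕ a / g < q
    a/g<q = m<n*o⇒m/o<n (subst (toℕ a <_) (sym q*g≡M) (FP.toℕ<n a))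
    a/g↦a : toℕ (scaleUp (F.fromℕ< a/g<q)) ≡ toℕ a
    a/g↦a = trans (toℕ-scaleUp (F.fromℕ< a/g<q)) (trans (cong (_* g) (FP.toℕ-fromℕ< a/g<q)) (m/n*n≡m g∣a))

zeroSumFreeWithGcd? : ∀ {d} M g (x : Vec (Fin M) d) → Dec (ZeroSumFree M x × gcdVec M x ≡ g)
zeroSumFreeWithGcd? M g x = zeroSumFree? M x ×-dec (gcdVec M x ℕP.≟ g)

count-zeroSumFreeWithGcd : ∀ {M g} d → 1 ≤ M → g ∣ M →
            ∑ (allTuples M d) (λ x → indicator (zeroSumFreeWithGcd? M g x)) ≡ β (M div g) d
count-zeroSumFreeWithGcd {M} {g} d 1≤M g∣M = begin
  ∑ (allTuples M d) withGcd
    ≡⟨ ∑-reindex (VP.≡-dec FP._≟_) (V.map scaleUp) withGcd (allTuples-unique q d) (allTuples-unique M d)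
                 (λ _ → ∈-allTuples _) (λ _ _ → map-injective scaleUp-injective) onto ⟩
  ∑ (allTuples q d) (λ y → withGcd (V.map scaleUp y))
    ≡⟨ ∑-cong (allTuples q d) (λ {y} _ →
         indicator-cong (zeroSumFreeWithGcd? M g (V.map scaleUp y)) (irreducible? q y) (irreducible⇔ y)) ⟩
  ∑ (allTuples q d) (λ y → indicator (irreducible? q y))
    ≡⟨ sym (length-filter (irreducible? q) (allTuples q d)) ⟩
  β q d ∎
  where
  open ≡.≡-Reasoning
  q = M div g
  open Scaling {q = q} (div*≡ 1≤M g∣M) (∣⇒positive 1≤M g∣M)
  withGcd : Vec (Fin M) d → ℕ
  withGcd x = indicator (zeroSumFreeWithGcd? M g x)
  onto : ∀ {x} → x ∈ allTuples M d → withGcd x ≡ 0 ⊎ ∃ λ y → y ∈ allTuples q d × V.map scaleUp y ≡ x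
  onto {x} _ with zeroSumFreeWithGcd? M g x
  ... | no _ = inj₁ refl
  ... | yes (_ , gcd≡g)
    with scaleUp-surjective x (proj₂ (Equivalence.to (∣gcdVec⇔ g x) (subst (g ∣_) (sym gcd≡g) ∣-refl)))
  ... | y , y↦x = inj₂ (y , ∈-allTuples y , y↦x)

indicator-zeroSumFree : ∀ {M d} → 1 ≤ M → (x : Vec (Fin M) d) →
  indicator (zeroSumFree? M x) ≡ ∑ (divisors M) (λ g → indicator (zeroSumFreeWithGcd? M g x))
indicator-zeroSumFree {M} 1≤M x = by-cases (zeroSumFree? M x)
  where
  other : ∀ {g} → g ∈ divisors M → g ≢ gcdVec M x → indicator (zeroSumFreeWithGcd? M g x) ≡ 0
  other {g} _ g≢gcd = indicator-no (zeroSumFreeWithGcd? M g x) (g≢gcd ∘ sym ∘ proj₂)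
  by-cases : Dec (ZeroSumFree M x) →
             indicator (zeroSumFree? M x) ≡ ∑ (divisors M) (λ g → indicator (zeroSumFreeWithGcd? M g x))
  by-cases (yes free) = trans (indicator-yes (zeroSumFree? M x) free) (sym (trans
    (∑-single (divisors-unique M) (∈-divisors⁺ 1≤M (gcdVec∣ x)) other)
    (indicator-yes (zeroSumFreeWithGcd? M (gcdVec M x) x) (free , refl))))
  by-cases (no ¬free) = trans (indicator-no (zeroSumFree? M x) ¬free) (sym
    (∑-zero (divisors M) λ {g} _ → indicator-no (zeroSumFreeWithGcd? M g x) (¬free ∘ proj₁)))

α≡∑β : ∀ {M} d → 1 ≤ M → α M d ≡ Σdiv M (λ m → β m d)
α≡∑β {M} d 1≤M = begin
  α M d
    ≡⟨ length-filter (zeroSumFree? M) (allTuples M d) ⟩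
  ∑ (allTuples M d) (λ x → indicator (zeroSumFree? M x))
    ≡⟨ ∑-cong (allTuples M d) (λ {x} _ → indicator-zeroSumFree 1≤M x) ⟩
  ∑ (allTuples M d) (λ x → ∑ (divisors M) (λ g → indicator (zeroSumFreeWithGcd? M g x)))
    ≡⟨ ∑-comm (allTuples M d) (divisors M) _ ⟩
  ∑ (divisors M) (λ g → ∑ (allTuples M d) (λ x → indicator (zeroSumFreeWithGcd? M g x)))
    ≡⟨ ∑-cong (divisors M) (λ g∈ → count-zeroSumFreeWithGcd d 1≤M (proj₁ (∈-divisors⁻ M g∈))) ⟩
  ∑ (divisors M) (λ g → β (M div g) d)
    ≡⟨ sym (∑-divisors-complement 1≤M (λ m → β m d)) ⟩
  Σdiv M (λ m → β m d) ∎
  where open ≡.≡-Reasoning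

prime⇒≥2 : ∀ {p} → Prime p → 2 ≤ p
prime⇒≥2 {p} p-prime = ℕ.nonTrivial⇒n>1 p {{prime⇒nonTrivial p-prime}}

prime⇒positive : ∀ {p} → Prime p → 1 ≤ p
prime⇒positive = ℕP.<⇒≤ ∘ prime⇒≥2

prime∣prime⇒≡ : ∀ {p q} → Prime p → Prime q → q ∣ p → q ≡ p
prime∣prime⇒≡ p-prime q-prime q∣p with prime⇒irreducible p-prime q∣p
... | inj₁ refl = contradiction (prime⇒≥2 q-prime) (ℕP.<-irrefl refl)
... | inj₂ q≡p  = q≡p

∃prime∣ : ∀ {n} → 2 ≤ n → ∃ λ p → Prime p × p ∣ n
∃prime∣ {suc n} 2≤n with factorise (suc n)
... | record { factors = [] ; isFactorisation = n≡1 } = contradiction n≡1 (ℕP.>⇒≢ 2≤n)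
... | record { factors = p ∷ ps ; isFactorisation = n≡p*ps ; factorsPrime = p-prime All.∷ _ } =
  p , p-prime , divides (product ps) (trans n≡p*ps (ℕP.*-comm p (product ps)))

squareFree⇔ : ∀ {x} → 1 ≤ x → SquareFree x ⇔ (∀ {p} → Prime p → ¬ p * p ∣ x)
squareFree⇔ {x} 1≤x = mk⇔ to from
  where
  to : SquareFree x → ∀ {p} → Prime p → ¬ p * p ∣ x
  to sf {suc p} p-prime p²∣x = All.lookup sf (∈-map⁺ suc (∈-oneTo⁺ (ℕP.≤-pred (prime⇒≥2 p-prime)) p≤x)) p²∣x
    where
    p≤x : p ≤ x
    p≤x = ℕP.≤-trans (ℕP.n≤1+n p) (ℕP.≤-trans (ℕP.m≤m*n (suc p) (suc p)) (∣⇒≤ {{ℕ.>-nonZero 1≤x}} p²∣x))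
  from : (∀ {p} → Prime p → ¬ p * p ∣ x) → SquareFree x
  from no-p² = All.tabulate λ k∈ k²∣x → no-k² k∈ k²∣x
    where
    no-k² : ∀ {k} → k ∈ L.map suc (oneTo x) → ¬ k * k ∣ x
    no-k² k∈ k²∣x with ∈-map⁻ suc k∈
    ... | k′ , k′∈ , refl with ∃prime∣ (s≤s (proj₁ (∈-oneTo⁻ x k′∈)))
    ...   | p , p-prime , p∣k = no-p² p-prime (∣-trans (*-pres-∣ p∣k p∣k) k²∣x)

prime²∣p*a⇒ : ∀ {p q a} → Prime p → Prime q → ¬ p ∣ a → q * q ∣ p * a → q * q ∣ a
prime²∣p*a⇒ {p} {q} {a} p-prime q-prime p∤a q²∣pa with q ℕP.≟ p
... | yes refl = contradiction (*-cancelˡ-∣ p {{prime⇒nonZero p-prime}} q²∣pa) p∤a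
... | no q≢p with euclidsLemma p a q-prime (∣-trans (∣m⇒∣m*n q ∣-refl) q²∣pa)
...   | inj₁ q∣p = contradiction (prime∣prime⇒≡ p-prime q-prime q∣p) q≢p
...   | inj₂ (divides c refl)
  with euclidsLemma p c q-prime (*-cancelʳ-∣ q {{prime⇒nonZero q-prime}} (subst (q * q ∣_) (sym (ℕP.*-assoc p c q)) q²∣pa))
...     | inj₁ q∣p = contradiction (prime∣prime⇒≡ p-prime q-prime q∣p) q≢p
...     | inj₂ q∣c = *-monoˡ-∣ q q∣c

squareFree-*⇔ : ∀ {p a} → Prime p → ¬ p ∣ a → 1 ≤ a → SquareFree (p * a) ⇔ SquareFree a
squareFree-*⇔ {p} {a} p-prime p∤a 1≤a = mk⇔
  (λ sf → Equivalence.from (squareFree⇔ 1≤a) λ q-prime q²∣a →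
    Equivalence.to (squareFree⇔ 1≤pa) sf q-prime (∣n⇒∣m*n p q²∣a))
  (λ sf → Equivalence.from (squareFree⇔ 1≤pa) λ q-prime q²∣pa →
    Equivalence.to (squareFree⇔ 1≤a) sf q-prime (prime²∣p*a⇒ p-prime q-prime p∤a q²∣pa))
  where
  1≤pa : 1 ≤ p * a
  1≤pa = ℕP.*-mono-≤ (prime⇒positive p-prime) 1≤a

primeDivisor? : ∀ x q → Dec (Prime q × q ∣ x)
primeDivisor? x q = prime? q ×-dec (q ∣? x)

ω-* : ∀ {p a} → Prime p → ¬ p ∣ a → 1 ≤ a → ω (p * a) ≡ suc (ω a)
ω-* {p} {a} p-prime p∤a 1≤a = begin
  ω (p * a)
    ≡⟨ length-filter (primeDivisor? (p * a)) (oneTo (p * a)) ⟩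
  ∑ (oneTo (p * a)) (λ q → indicator (primeDivisor? (p * a) q))
    ≡⟨ ∑-cong (oneTo (p * a)) (λ {q} _ → indicator-⊎ (primeDivisor? (p * a) q) (primeDivisor? a q) (q ℕP.≟ p)
         (split q) (λ (q-prime , q∣a) → q-prime , ∣n⇒∣m*n p q∣a) (λ { refl → p-prime , ∣m⇒∣m*n a ∣-refl })
         λ { ((_ , p∣a) , refl) → p∤a p∣a }) ⟩
  ∑ (oneTo (p * a)) (λ q → indicator (primeDivisor? a q) + indicator (q ℕP.≟ p))
    ≡⟨ ∑-distrib-+ (oneTo (p * a)) _ _ ⟩
  ∑ (oneTo (p * a)) (λ q → indicator (primeDivisor? a q)) + ∑ (oneTo (p * a)) (λ q → indicator (q ℕP.≟ p))
    ≡⟨ cong₂ _+_ (sym primes-of-a) just-p ⟩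
  ω a + 1
    ≡⟨ ℕP.+-comm (ω a) 1 ⟩
  suc (ω a) ∎
  where
  open ≡.≡-Reasoning
  1≤p = prime⇒positive p-prime
  split : ∀ q → Prime q × q ∣ p * a → (Prime q × q ∣ a) ⊎ q ≡ p
  split q (q-prime , q∣pa) with euclidsLemma p a q-prime q∣pa
  ... | inj₁ q∣p = inj₂ (prime∣prime⇒≡ p-prime q-prime q∣p)
  ... | inj₂ q∣a = inj₁ (q-prime , q∣a)
  primes-of-a : ω a ≡ ∑ (oneTo (p * a)) (λ q → indicator (primeDivisor? a q))
  primes-of-a = trans (length-filter (primeDivisor? a) (oneTo a)) (sym
    (∑-reindex ℕP._≟_ (λ q → q) _ (oneTo-unique a) (oneTo-unique (p * a))
      (λ q∈ → let 1≤q , q≤a = ∈-oneTo⁻ a q∈ in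
              ∈-oneTo⁺ 1≤q (ℕP.≤-trans q≤a (ℕP.m≤n*m a p {{ℕ.>-nonZero 1≤p}})))
      (λ _ _ q≡q′ → q≡q′)
      onto))
    where
    onto : ∀ {q} → q ∈ oneTo (p * a) → indicator (primeDivisor? a q) ≡ 0 ⊎ ∃ λ q′ → q′ ∈ oneTo a × q′ ≡ q
    onto {q} _ with primeDivisor? a q
    ... | no _ = inj₁ refl
    ... | yes (q-prime , q∣a) =
      inj₂ (q , ∈-oneTo⁺ (prime⇒positive q-prime) (∣⇒≤ {{ℕ.>-nonZero 1≤a}} q∣a) , refl)
  just-p : ∑ (oneTo (p * a)) (λ q → indicator (q ℕP.≟ p)) ≡ 1
  just-p = trans (∑-single (oneTo-unique (p * a)) (∈-oneTo⁺ 1≤p (ℕP.m≤m*n p a {{ℕ.>-nonZero 1≤a}}))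
                           (λ {q} _ q≢p → indicator-no (q ℕP.≟ p) q≢p))
                 (indicator-yes (p ℕP.≟ p) refl)

μ-squareFree : ∀ {x} → SquareFree x → μ x ≡ negOnePow (ω x)
μ-squareFree {x} sf with squareFree? x
... | yes _  = refl
... | no ¬sf = contradiction sf ¬sf

μ-nonSquareFree : ∀ {x} → ¬ SquareFree x → μ x ≡ + 0
μ-nonSquareFree {x} ¬sf with squareFree? x
... | yes sf = contradiction sf ¬sf
... | no _   = refl

μ-* : ∀ {p a} → Prime p → ¬ p ∣ a → 1 ≤ a → μ (p * a) ≡ ℤ.- μ a
μ-* {p} {a} p-prime p∤a 1≤a with squareFree? a
... | yes sf = trans (μ-squareFree (Equivalence.from (squareFree-*⇔ p-prime p∤a 1≤a) sf))
                     (cong negOnePow (ω-* p-prime p∤a 1≤a))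
... | no ¬sf = μ-nonSquareFree (¬sf ∘ Equivalence.to (squareFree-*⇔ p-prime p∤a 1≤a))

module ℤ∑ = ListSum ℤP.+-*-commutativeSemiring
open ℤ∑ using () renaming (∑ to ∑ℤ)
module ℤDivisorSum = DivisorSum ℤP.+-*-commutativeSemiring

∑ℤ-neg : ∀ {a} {A : Set a} (xs : List A) f → ∑ℤ xs (λ x → ℤ.- f x) ≡ ℤ.- ∑ℤ xs f
∑ℤ-neg xs f = begin
  ∑ℤ xs (λ x → ℤ.- f x)         ≡⟨ ℤ∑.∑-cong xs (λ {x} _ → sym (ℤP.-1*i≡-i (f x))) ⟩
  ∑ℤ xs (λ x → ℤ.-1ℤ ℤ.* f x)  ≡⟨ ℤ∑.∑-distribˡ-* xs ℤ.-1ℤ f ⟩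
  ℤ.-1ℤ ℤ.* ∑ℤ xs f            ≡⟨ ℤP.-1*i≡-i (∑ℤ xs f) ⟩
  ℤ.- ∑ℤ xs f                  ∎
  where open ≡.≡-Reasoning

+-∑ : ∀ {a} {A : Set a} (xs : List A) f → + ∑ xs f ≡ ∑ℤ xs (λ x → + f x)
+-∑ []       f = refl
+-∑ (x ∷ xs) f = cong (ℤ._+_ (+ f x)) (+-∑ xs f)

prime∣∧∣⇒*∣ : ∀ {p a n} → Prime p → p ∣ n → a ∣ n → ¬ p ∣ a → p * a ∣ n
prime∣∧∣⇒*∣ {p} {a} p-prime p∣n (divides c refl) p∤a with euclidsLemma c a p-prime p∣n
... | inj₁ (divides c′ refl) = divides c′ (ℕP.*-assoc c′ p a)
... | inj₂ p∣a               = contradiction p∣a p∤a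

-- Split the divisors of N by divisibility by a prime p ∣ N: e ↦ p e pairs off the two halves with
-- opposite signs, and the divisors divisible by p² contribute nothing.
∑μ-divisors≡0 : ∀ {N} → 2 ≤ N → ∑ℤ (divisors N) μ ≡ + 0
∑μ-divisors≡0 {N} 2≤N with ∃prime∣ 2≤N
... | p , p-prime , p∣N = begin
  ∑ℤ (divisors N) μ                    ≡⟨ ℤ∑.∑-partition (p ∣?_) (divisors N) μ ⟩
  ∑ℤ multiples μ ℤ.+ ∑ℤ nonMultiples μ ≡⟨ cong (ℤ._+ ∑ℤ nonMultiples μ) multiples≡-nonMultiples ⟩
  ℤ.- ∑ℤ nonMultiples μ ℤ.+ ∑ℤ nonMultiples μ ≡⟨ ℤP.+-inverseˡ (∑ℤ nonMultiples μ) ⟩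
  + 0                                  ∎
  where
  open ≡.≡-Reasoning
  1≤N = ℕP.<⇒≤ 2≤N
  1≤p = prime⇒positive p-prime
  multiples nonMultiples : List ℕ
  multiples    = filter (p ∣?_) (divisors N)
  nonMultiples = filter (¬? ∘ (p ∣?_)) (divisors N)
  onto : ∀ {e} → e ∈ multiples → μ e ≡ + 0 ⊎ ∃ λ a → a ∈ nonMultiples × p * a ≡ e
  onto e∈ with ∈-filter⁻ (p ∣?_) {xs = divisors N} e∈
  ... | e∈D , divides c refl with p ∣? c
  ...   | yes p∣c = inj₁ (μ-nonSquareFree λ sf →
            Equivalence.to (squareFree⇔ (proj₂ (∈-divisors⁻ N e∈D))) sf p-prime
              (subst (p * p ∣_) (ℕP.*-comm p c) (*-monoʳ-∣ p p∣c)))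
  ...   | no p∤c = inj₂ (c , ∈-filter⁺ (¬? ∘ (p ∣?_)) c∈D p∤c , ℕP.*-comm p c)
    where
    c∈D : c ∈ divisors N
    c∈D = ∈-divisors⁺ 1≤N (∣-trans (∣m⇒∣m*n p ∣-refl) (proj₁ (∈-divisors⁻ N e∈D)))
  multiples≡-nonMultiples : ∑ℤ multiples μ ≡ ℤ.- ∑ℤ nonMultiples μ
  multiples≡-nonMultiples = begin
    ∑ℤ multiples μ
      ≡⟨ ℤ∑.∑-reindex ℕP._≟_ (p *_) μ
           (Unique.filter⁺ (¬? ∘ (p ∣?_)) (divisors-unique N)) (Unique.filter⁺ (p ∣?_) (divisors-unique N))
           (λ a∈ → let a∈D , p∤a = ∈-filter⁻ (¬? ∘ (p ∣?_)) {xs = divisors N} a∈ in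
                   ∈-filter⁺ (p ∣?_) (∈-divisors⁺ 1≤N (prime∣∧∣⇒*∣ p-prime p∣N (proj₁ (∈-divisors⁻ N a∈D)) p∤a))
                             (∣m⇒∣m*n _ ∣-refl))
           (λ _ _ → ℕP.*-cancelˡ-≡ _ _ p {{ℕ.>-nonZero 1≤p}})
           onto ⟩
    ∑ℤ nonMultiples (λ a → μ (p * a))
      ≡⟨ ℤ∑.∑-cong nonMultiples (λ a∈ → let a∈D , p∤a = ∈-filter⁻ (¬? ∘ (p ∣?_)) {xs = divisors N} a∈ in
                                              μ-* p-prime p∤a (proj₂ (∈-divisors⁻ N a∈D))) ⟩
    ∑ℤ nonMultiples (λ a → ℤ.- μ a)
      ≡⟨ ∑ℤ-neg nonMultiples μ ⟩
    ℤ.- ∑ℤ nonMultiples μ ∎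

∑μ-divisors : ∀ {N} → 1 ≤ N → ∑ℤ (divisors N) μ ≡ ℤ∑.indicator (N ℕP.≟ 1)
∑μ-divisors {suc zero}    _ = refl
∑μ-divisors {suc (suc N)} _ = ∑μ-divisors≡0 {suc (suc N)} (s≤s (s≤s z≤n))

div-div≡div-* : ∀ {n l k} → 1 ≤ n → l ∣ n → k ∣ n div l → (n div l) div k ≡ n div (l * k)
div-div≡div-* {n} {l} {k} 1≤n l∣n k∣n/l = sym (div-unique (ℕP.*-mono-≤ 1≤l 1≤k) (begin
  (n div l) div k * (l * k)   ≡⟨ swap ((n div l) div k) l k ⟩
  (n div l) div k * k * l     ≡⟨ cong (_* l) (div*≡ (div-positive 1≤n l∣n) k∣n/l) ⟩
  n div l * l                 ≡⟨ div*≡ 1≤n l∣n ⟩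
  n                           ∎))
  where
  open ≡.≡-Reasoning
  1≤l = ∣⇒positive 1≤n l∣n
  1≤k = ∣⇒positive (div-positive 1≤n l∣n) k∣n/l
  swap : ∀ x l k → x * (l * k) ≡ x * k * l
  swap = solve-∀

∑-multiples-μ : ∀ {n l} → 1 ≤ n → l ∣ n →
                ∑ℤ (divisors n) (λ m → ℤ∑.indicator (l ∣? m) ℤ.* μ (n div m)) ≡ ℤ∑.indicator (n div l ℕP.≟ 1)
∑-multiples-μ {n} {l} 1≤n l∣n = begin
  ∑ℤ (divisors n) (λ m → ℤ∑.indicator (l ∣? m) ℤ.* μ (n div m))
    ≡⟨ ℤDivisorSum.∑-divisors-multiples 1≤n l∣n (λ m → μ (n div m)) ⟩
  ∑ℤ (divisors (n div l)) (λ k → μ (n div (l * k)))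
    ≡⟨ ℤ∑.∑-cong (divisors (n div l)) (λ k∈ →
         cong μ (sym (div-div≡div-* 1≤n l∣n (proj₁ (∈-divisors⁻ (n div l) k∈))))) ⟩
  ∑ℤ (divisors (n div l)) (λ k → μ ((n div l) div k))
    ≡⟨ sym (ℤDivisorSum.∑-divisors-complement (div-positive 1≤n l∣n) μ) ⟩
  ∑ℤ (divisors (n div l)) μ
    ≡⟨ ∑μ-divisors (div-positive 1≤n l∣n) ⟩
  ℤ∑.indicator (n div l ℕP.≟ 1) ∎
  where open ≡.≡-Reasoning

möbius-inversion : ∀ n d → 1 ≤ n → + β n d ≡ Σdivℤ n (λ m → μ (n div m) *ℤ + α m d)
möbius-inversion n d 1≤n = sym (begin
  ∑ℤ D (λ m → μ (n div m) ℤ.* + α m d)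
    ≡⟨ ℤ∑.∑-cong D (λ {m} m∈ → cong (μ (n div m) ℤ.*_) (α-as-∑ (proj₁ (∈-divisors⁻ n m∈)))) ⟩
  ∑ℤ D (λ m → μ (n div m) ℤ.* ∑ℤ D (term m))
    ≡⟨ ℤ∑.∑-cong D (λ {m} _ → sym (ℤ∑.∑-distribˡ-* D (μ (n div m)) (term m))) ⟩
  ∑ℤ D (λ m → ∑ℤ D (λ l → μ (n div m) ℤ.* term m l))
    ≡⟨ ℤ∑.∑-comm D D (λ m l → μ (n div m) ℤ.* term m l) ⟩
  ∑ℤ D (λ l → ∑ℤ D (λ m → μ (n div m) ℤ.* term m l))
    ≡⟨ ℤ∑.∑-cong D (λ {l} _ → trans
         (ℤ∑.∑-cong D (λ {m} _ → rearrange (μ (n div m)) (ℤ∑.indicator (l ∣? m)) (+ β l d)))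
         (ℤ∑.∑-distribʳ-* D (+ β l d) (λ m → ℤ∑.indicator (l ∣? m) ℤ.* μ (n div m)))) ⟩
  ∑ℤ D (λ l → ∑ℤ D (λ m → ℤ∑.indicator (l ∣? m) ℤ.* μ (n div m)) ℤ.* + β l d)
    ≡⟨ ℤ∑.∑-cong D (λ {l} l∈ → cong (ℤ._* + β l d) (∑-multiples-μ 1≤n (proj₁ (∈-divisors⁻ n l∈)))) ⟩
  ∑ℤ D (λ l → ℤ∑.indicator (n div l ℕP.≟ 1) ℤ.* + β l d)
    ≡⟨ ℤ∑.∑-single (divisors-unique n) (∈-divisors⁺ 1≤n ∣-refl) other ⟩
  ℤ∑.indicator (n div n ℕP.≟ 1) ℤ.* + β n d
    ≡⟨ ℤ∑.indicator-*-yes (n div n ℕP.≟ 1) (div-unique 1≤n (ℕP.*-identityˡ n)) (+ β n d) ⟩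
  + β n d ∎)
  where
  open ≡.≡-Reasoning
  D = divisors n
  term : ℕ → ℕ → ℤ
  term m l = ℤ∑.indicator (l ∣? m) ℤ.* + β l d
  α-as-∑ : ∀ {m} → m ∣ n → + α m d ≡ ∑ℤ D (term m)
  α-as-∑ {m} m∣n = begin
    + α m d                          ≡⟨ cong +_ (α≡∑β d (∣⇒positive 1≤n m∣n)) ⟩
    + ∑ (divisors m) (λ l → β l d)   ≡⟨ +-∑ (divisors m) (λ l → β l d) ⟩
    ∑ℤ (divisors m) (λ l → + β l d)  ≡⟨ ℤDivisorSum.∑-divisors-of-divisor 1≤n m∣n (λ l → + β l d) ⟩
    ∑ℤ D (term m) ∎
  rearrange : ∀ x y z → x ℤ.* (y ℤ.* z) ≡ y ℤ.* x ℤ.* z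
  rearrange x y z = trans (sym (ℤP.*-assoc x y z)) (cong (ℤ._* z) (ℤP.*-comm x y))
  other : ∀ {l} → l ∈ D → l ≢ n → ℤ∑.indicator (n div l ℕP.≟ 1) ℤ.* + β l d ≡ + 0
  other l∈ l≢n = ℤ∑.indicator-*-no (_ ℕP.≟ 1) (l≢n ∘ div≡1⇒≡ 1≤n (proj₁ (∈-divisors⁻ n l∈))) _

-- block i j selects the positions t with i ≤ t < j.
block : ∀ {d} → ℕ → ℕ → Subset d
block {zero}  _       _       = []
block {suc d} zero    zero    = outside ∷ block zero zero
block {suc d} zero    (suc j) = inside ∷ block zero j
block {suc d} (suc i) zero    = outside ∷ block i zero
block {suc d} (suc i) (suc j) = outside ∷ block i j

subsetSum-block-empty : ∀ {m d} (y : Vec (Fin m) d) → subsetSum (block 0 0) y ≡ 0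
subsetSum-block-empty []      = refl
subsetSum-block-empty (a ∷ y) = subsetSum-block-empty y

subsetSum-block-split : ∀ {m d} {i j} (y : Vec (Fin m) d) → i ≤ j →
  subsetSum (block 0 j) y ≡ subsetSum (block 0 i) y + subsetSum (block i j) y
subsetSum-block-split []                _         = refl
subsetSum-block-split {i = zero} {j} (a ∷ y) _ =
  cong (_+ subsetSum (block 0 j) (a ∷ y)) (sym (subsetSum-block-empty (a ∷ y)))
subsetSum-block-split {i = suc i} {suc j} (a ∷ y) (s≤s i≤j) =
  trans (cong (λ s → toℕ a + s) (subsetSum-block-split y i≤j)) (sym (ℕP.+-assoc (toℕ a) _ _))

block-nonempty : ∀ {d i j} → i < j → j ≤ d → Nonempty (block {d} i j)
block-nonempty {suc d} {zero}  {suc j} _         _         = F.zero , V.here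
block-nonempty {suc d} {suc i} {suc j} (s≤s i<j) (s≤s j≤d) with block-nonempty i<j j≤d
... | t , t∈ = F.suc t , V.there t∈

prefixSum : ∀ {m d} → Vec (Fin (suc m)) d → Fin (suc d) → Fin (suc m)
prefixSum y j = subsetSum (block 0 (toℕ j)) y mod _

length≥⇒zeroSum : ∀ {m d} (y : Vec (Fin (suc m)) d) → suc m ≤ d → ∃ (ZeroSumSubset (suc m) y)
length≥⇒zeroSum {m} y m<d with FP.pigeonhole (s≤s m<d) (prefixSum y)
... | i , j , i<j , same = block (toℕ i) (toℕ j) , block-nonempty i<j (ℕP.≤-pred (FP.toℕ<n j)) , m∣block
  where
  m∣block : suc m ∣ subsetSum (block (toℕ i) (toℕ j)) y
  m∣block = [m+n]%o≡m%o⇒o∣n (subsetSum (block 0 (toℕ i)) y) _ (suc m) (begin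
    (subsetSum (block 0 (toℕ i)) y + subsetSum (block (toℕ i) (toℕ j)) y) % suc m
      ≡⟨ cong (_% suc m) (sym (subsetSum-block-split y (ℕP.<⇒≤ i<j))) ⟩
    subsetSum (block 0 (toℕ j)) y % suc m
      ≡⟨ sym (toℕ-mod (subsetSum (block 0 (toℕ j)) y) (suc m)) ⟩
    toℕ (prefixSum y j)
      ≡⟨ cong toℕ (sym same) ⟩
    toℕ (prefixSum y i)
      ≡⟨ toℕ-mod (subsetSum (block 0 (toℕ i)) y) (suc m) ⟩
    subsetSum (block 0 (toℕ i)) y % suc m ∎)
    where open ≡.≡-Reasoning

zeroSumFree⇒length< : ∀ {m d} (y : Vec (Fin m) d) → 1 ≤ m → ZeroSumFree m y → d < m
zeroSumFree⇒length< {suc m} y _ free = ℕP.≰⇒> (free ∘ length≥⇒zeroSum y)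

β≡0 : ∀ {m d} → 1 ≤ m → m ≤ d → β m d ≡ 0
β≡0 {m} {d} 1≤m m≤d = trans (length-filter (irreducible? m) (allTuples m d))
  (∑-zero (allTuples m d) λ {y} _ → indicator-no (irreducible? m y) λ (free , _) →
    ℕP.<⇒≱ (zeroSumFree⇒length< y 1≤m free) m≤d)

α≡β : ∀ {n} d → 1 ≤ n → (∀ m → 1 ≤ m → m < n → m ∣ n → m ≤ d) → α n d ≡ β n d
α≡β {n} d 1≤n proper≤d = trans (α≡∑β d 1≤n)
  (∑-single (divisors-unique n) (∈-divisors⁺ 1≤n ∣-refl) λ {m} m∈ m≢n →
    let m∣n , 1≤m = ∈-divisors⁻ n m∈ in
    β≡0 1≤m (proper≤d m 1≤m (ℕP.≤∧≢⇒< (∣⇒≤ {{ℕ.>-nonZero 1≤n}} m∣n) m≢n) m∣n))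

properDivisor≤half : ∀ {m n d} → m < n → m ∣ n → n ≤ 2 * d → m ≤ d
properDivisor≤half {m} m<n (divides c refl) n≤2d =
  ℕP.*-cancelˡ-≤ 2 (ℕP.≤-trans (ℕP.*-monoˡ-≤ m (2≤c c m<n)) n≤2d)
  where
  2≤c : ∀ c → m < c * m → 2 ≤ c
  2≤c zero          ()
  2≤c (suc zero)    m<m = contradiction m<m (ℕP.<-irrefl (sym (ℕP.+-identityʳ m)))
  2≤c (suc (suc c)) _   = s≤s (s≤s z≤n)

theorem2p2 : (n d : ℕ) → 3 ≤ n → 1 ≤ d → d < n →
    -- (a)
    ((k : ℕ) (x : Vec (Fin n) d) → IsAut n k → ZeroSumFree n x →
        (InStab k x ⇔ ((n div gcd (k ∸ 1) n) ∣ gcdVec n x))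
        × (gcdVec n x ≡ 1 → (InStab k x ⇔ k ≡ 1)))
    -- (b)
    × ((∃ λ (R : List (Vec (Fin n) d)) → OrbitTransversal n d R)
       × ((R : List (Vec (Fin n) d)) → OrbitTransversal n d R → length R ≡ β n d div φ n)
       × (φ n ∣ β n d))
    -- (c)
    × (α n d ≡ Σdiv n (λ m → β m d)
       × + β n d ≡ Σdivℤ n (λ m → μ (n div m) *ℤ + α m d))
    -- (d)
    × (((∀ m → 1 ≤ m → m < n → m ∣ n → m ≤ d) → α n d ≡ β n d × φ n ∣ α n d)
       × (n ≤ 2 * d → α n d ≡ β n d × φ n ∣ α n d))
theorem2p2 n d 3≤n _ _ =
    (λ k x k-aut _ → inStab⇔ k x k-aut , inStab⇔≡1 k x k-aut)
  , orbit-count n d 1<n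
  , (α≡∑β d 1≤n , möbius-inversion n d 1≤n)
  , (α≡β∧φ∣α , λ n≤2d → α≡β∧φ∣α (λ m _ m<n m∣n → properDivisor≤half m<n m∣n n≤2d))
  where
  1<n : 1 < n
  1<n = ℕP.<-≤-trans (s≤s (s≤s z≤n)) 3≤n
  1≤n : 1 ≤ n
  1≤n = ℕP.<⇒≤ 1<n
  α≡β∧φ∣α : (∀ m → 1 ≤ m → m < n → m ∣ n → m ≤ d) → α n d ≡ β n d × φ n ∣ α n d
  α≡β∧φ∣α proper≤d = α≡β d 1≤n proper≤d
                   , subst (φ n ∣_) (sym (α≡β d 1≤n proper≤d)) (proj₂ (proj₂ (orbit-count n d 1<n)))
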